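{- Let $p: L\to R$ be a production. Any consistent precondition for $p$ is equivalent to some consistent postcondition for $p$, and any consistent postcondition for $p$ is equivalent to some consistent precondition for $p$.
   Context: Matrix Graph Grammars (MGG): simple digraphs $G=(M,V)$ with Boolean adjacency matrix and node vector and typed nodes; a production $p:L\to R$ is a partial injective typed morphism with deletion part $e = L\overline{R}$, addition part $r = R\overline{L}$ and nihilation matrix $K$ (forbidden edges: those added by $p$ and those incident to deleted nodes); it is applied to a host graph $G$ via injective matches of $L$ in $G$ and $K$ in $\overline{G}$, yielding $p(G) = r\vee\overline{e}G$. A graph constraint is a diagram (simple digraphs with partial injective morphisms, all cycles commuting) plus a monadic second order formula in predicates $P$ (total inclusion in the evaluated graph) and $Q$ (partial morphism into the evaluated graph defined on at least one edge). An application condition for $p$ is a graph constraint whose diagram contains $L$ and $K$ and whose formula demands $L$ in $G$ and $K$ in $\overline{G}$. A precondition is an application condition set on the LHS (evaluated on the host graph $G$ before applying $p$); a postcondition is one set on the RHS (evaluated on $p(G)$). Such a condition is consistent if there exists a host graph satisfying it to which $p$ is applicable. A precondition and a postcondition are equivalent when, for every host graph $G$ and match, $G$ satisfies the precondition if and only if $p(G)$ satisfies the postcondition. -}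

module Defs where

open import Data.Nat using (ℕ; zero; suc; _+_)
open import Data.Fin using (Fin; zero; suc; _≟_)
open import Data.Bool using (Bool; true; false; _∧_; _∨_; not; if_then_else_)
open import Data.Maybe using (Maybe; just; nothing; _>>=_)
open import Data.Product using (Σ; _×_; _,_)
open import Data.Unit using (⊤)
open import Data.Empty using (⊥)
open import Data.Sum using (_⊎_)
open import Relation.Nullary using (¬_; yes; no)
open import Relation.Nullary.Decidable using (⌊_⌋)
open import Relation.Binary.PropositionalEquality using (_≡_; refl; sym; trans; cong)
open import Function.Bundles using (_⇔_)

∧-l : ∀ x y → x ∧ y ≡ true → x ≡ true
∧-l true y _ = refl
∧-l false y ()

∧-r : ∀ x y → x ∧ y ≡ true → y ≡ true
∧-r true y p = p
∧-r false y ()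

mask-l : ∀ e x y → e ∧ (x ∧ y) ≡ true → x ≡ true
mask-l e x y h = ∧-l x y (∧-r e (x ∧ y) h)

mask-r : ∀ e x y → e ∧ (x ∧ y) ≡ true → y ≡ true
mask-r e x y h = ∧-r x y (∧-r e (x ∧ y) h)

just-inj : ∀ {A : Set} {x y : A} → just x ≡ just y → x ≡ y
just-inj refl = refl

anyFin : ∀ {N} → (Fin N → Bool) → Bool
anyFin {zero} f = false
anyFin {suc N} f = f zero ∨ anyFin (λ i → f (suc i))

-- Simple digraphs with typed nodes (MGG style: Boolean node vector V and
-- Boolean adjacency matrix M over a node universe Fin size; edges only
-- between present nodes).

record Graph (T : Set) : Set where
  field
    size : ℕ
    node : Fin size → Bool
    edge : Fin size → Fin size → Bool
    type : Fin size → T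
    edge-src : ∀ a b → edge a b ≡ true → node a ≡ true
    edge-tgt : ∀ a b → edge a b ≡ true → node b ≡ true
open Graph public

-- A partial injective typed node map from (the nodes of) A into the node
-- universe of G.  (For simple digraphs the edge part of a morphism is
-- determined by the node part.)
record PMap {T : Set} (A G : Graph T) : Set where
  field
    map : Fin (size A) → Maybe (Fin (size G))
    injective : ∀ a a' x → map a ≡ just x → map a' ≡ just x → a ≡ a'
    typed : ∀ a x → map a ≡ just x → type G x ≡ type A a
    on-nodes : ∀ a x → map a ≡ just x → node A a ≡ true
open PMap public

record PMor {T : Set} (A B : Graph T) : Set where
  field
    pmap : PMap A B
    lands : ∀ a x → map pmap a ≡ just x → node B x ≡ true
open PMor public

record Arrow {T : Set} {k : ℕ} (D : Fin k → Graph T) : Set where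
  field
    src : Fin k
    tgt : Fin k
    mor : PMor (D src) (D tgt)
open Arrow public

data Path {T : Set} {k : ℕ} (D : Fin k → Graph T) {na : ℕ}
          (arr : Fin na → Arrow D) : Fin k → Fin k → Set where
  []  : ∀ {i} → Path D arr i i
  _∷_ : ∀ {l} (j : Fin na) → Path D arr (tgt (arr j)) l → Path D arr (src (arr j)) l

compose : ∀ {T k} {D : Fin k → Graph T} {na} {arr : Fin na → Arrow D} {i l} →
          Path D arr i l → Fin (size (D i)) → Maybe (Fin (size (D l)))
compose [] a = just a
compose {arr = arr} (j ∷ p) a = map (pmap (mor (arr j))) a >>= compose p

Commutes : ∀ {T k} (D : Fin k → Graph T) {na} (arr : Fin na → Arrow D) → Set
Commutes D arr = ∀ i l (p q : Path D arr i l) a → compose p a ≡ compose q a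

-- P A t : the graph A is totally included in t; Q A t : the morphism
-- of A into t is defined on at least one edge; t is G or its complement.

data Target : Set where
  host co : Target

data Formula (k : ℕ) : Set where
  P Q : Fin k → Target → Formula k
  ¬F : Formula k → Formula k
  _∧F_ _∨F_ _⇒F_ : Formula k → Formula k → Formula k
  ∀F ∃F : Fin k → Formula k → Formula k

holds : Target → Bool → Bool
holds host b = b
holds co b = not b

NodeOK : ∀ {T} → Target → (G : Graph T) → Fin (size G) → Set
NodeOK host G x = node G x ≡ true
NodeOK co G x = ⊤

module Semantics {T : Set} {k : ℕ} (D : Fin k → Graph T) {na : ℕ}
                 (arr : Fin na → Arrow D) (G : Graph T) where

  Env : Set
  Env = (i : Fin k) → Maybe (PMap (D i) G)

  update : Env → (i : Fin k) → PMap (D i) G → Env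
  update ρ i μ j with i ≟ j
  ... | yes refl = just μ
  ... | no _ = ρ j

  Compatible : Env → Set
  Compatible ρ = ∀ (j : Fin na) μ ν → ρ (src (arr j)) ≡ just μ → ρ (tgt (arr j)) ≡ just ν →
                 ∀ a b → map (pmap (mor (arr j))) a ≡ just b → map μ a ≡ map ν b

  Total : ∀ {A : Graph T} → PMap A G → Target → Set
  Total {A} μ t =
    (∀ a → node A a ≡ true → Σ (Fin (size G)) λ x → (map μ a ≡ just x) × NodeOK t G x) ×
    (∀ a b x y → edge A a b ≡ true → map μ a ≡ just x → map μ b ≡ just y →
       holds t (edge G x y) ≡ true)

  OnSomeEdge : ∀ {A : Graph T} → PMap A G → Target → Set
  OnSomeEdge {A} μ t =
    Σ (Fin (size A)) λ a → Σ (Fin (size A)) λ b → Σ (Fin (size G)) λ x → Σ (Fin (size G)) λ y →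
      (edge A a b ≡ true) × (map μ a ≡ just x) × (map μ b ≡ just y) × (holds t (edge G x y) ≡ true)

  ⟦_⟧ : Formula k → Env → Set
  ⟦ P i t ⟧ ρ = Σ (PMap (D i) G) λ μ → (ρ i ≡ just μ) × Total μ t
  ⟦ Q i t ⟧ ρ = Σ (PMap (D i) G) λ μ → (ρ i ≡ just μ) × OnSomeEdge μ t
  ⟦ ¬F φ ⟧ ρ = ¬ ⟦ φ ⟧ ρ
  ⟦ φ ∧F ψ ⟧ ρ = ⟦ φ ⟧ ρ × ⟦ ψ ⟧ ρ
  ⟦ φ ∨F ψ ⟧ ρ = ⟦ φ ⟧ ρ ⊎ ⟦ ψ ⟧ ρ
  ⟦ φ ⇒F ψ ⟧ ρ = ⟦ φ ⟧ ρ → ⟦ ψ ⟧ ρ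
  ⟦ ∀F i φ ⟧ ρ = (μ : PMap (D i) G) → Compatible (update ρ i μ) → ⟦ φ ⟧ (update ρ i μ)
  ⟦ ∃F i φ ⟧ ρ = Σ (PMap (D i) G) λ μ → Compatible (update ρ i μ) × ⟦ φ ⟧ (update ρ i μ)

-- Productions (MGG representation: L and R over a common node universe
-- Fin N, the morphism L → R being the identity on common nodes; every
-- universe node belongs to L or R).

record Production (T : Set) : Set where
  field
    N : ℕ
    ty : Fin N → T
    VL VR : Fin N → Bool
    ML MR : Fin N → Fin N → Bool
    L-src : ∀ a b → ML a b ≡ true → VL a ≡ true
    L-tgt : ∀ a b → ML a b ≡ true → VL b ≡ true
    R-src : ∀ a b → MR a b ≡ true → VR a ≡ true
    R-tgt : ∀ a b → MR a b ≡ true → VR b ≡ true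
    covered : ∀ a → VL a ∨ VR a ≡ true
open Production public

module _ {T : Set} (p : Production T) where

  LHS : Graph T
  LHS = record { size = N p ; node = VL p ; edge = ML p ; type = ty p
               ; edge-src = L-src p ; edge-tgt = L-tgt p }

  RHS : Graph T
  RHS = record { size = N p ; node = VR p ; edge = MR p ; type = ty p
               ; edge-src = R-src p ; edge-tgt = R-tgt p }

  delNode addNode : Fin (N p) → Bool
  delNode a = VL p a ∧ not (VR p a)
  addNode a = VR p a ∧ not (VL p a)

  delEdge addEdge : Fin (N p) → Fin (N p) → Bool
  delEdge a b = ML p a b ∧ not (MR p a b)
  addEdge a b = MR p a b ∧ not (ML p a b)

  nihRaw : Fin (N p) → Fin (N p) → Bool
  nihRaw a b = addEdge a b ∨ ((delNode a ∨ delNode b) ∧ not (ML p a b))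

  Knode : Fin (N p) → Bool
  Knode a = VL p a ∨ VR p a

  Nih : Graph T
  Nih = record { size = N p ; node = Knode
               ; edge = λ a b → nihRaw a b ∧ (Knode a ∧ Knode b) ; type = ty p
               ; edge-src = λ a b e → mask-l (nihRaw a b) (Knode a) (Knode b) e
               ; edge-tgt = λ a b e → mask-r (nihRaw a b) (Knode a) (Knode b) e }

  inverse : Production T
  inverse = record { N = N p ; ty = ty p ; VL = VR p ; VR = VL p ; ML = MR p ; MR = ML p
                   ; L-src = R-src p ; L-tgt = R-tgt p ; R-src = L-src p ; R-tgt = L-tgt p
                   ; covered = λ a → cov a (VL p a) (VR p a) refl refl }
    where
    cov : ∀ a x y → VL p a ≡ x → VR p a ≡ y → VR p a ∨ VL p a ≡ true
    cov a true true e1 e2 rewrite e1 | e2 = refl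
    cov a true false e1 e2 rewrite e1 | e2 = refl
    cov a false true e1 e2 rewrite e1 | e2 = refl
    cov a false false e1 e2 with covered p a
    ... | c rewrite e1 | e2 = c

  record Match (G : Graph T) : Set where
    field
      m : Fin (N p) → Fin (size G)
      m-inj : ∀ a b → m a ≡ m b → a ≡ b
      m-typed : ∀ a → type G (m a) ≡ ty p a

  -- p is applicable at the match: L matched in G, K matched in Ḡ
  -- (K completed with the nodes of G: no dangling edges; added nodes are
  -- not already present).
  record Applicable (G : Graph T) (μ : Match G) : Set where
    open Match μ
    field
      L-nodes : ∀ a → VL p a ≡ true → node G (m a) ≡ true
      L-edges : ∀ a b → ML p a b ≡ true → edge G (m a) (m b) ≡ true
      K-nodes : ∀ a → addNode a ≡ true → node G (m a) ≡ false
      K-edges : ∀ a b → edge Nih a b ≡ true → edge G (m a) (m b) ≡ false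
      K-dangling-out : ∀ a x → delNode a ≡ true → edge G (m a) x ≡ true →
                       Σ (Fin (N p)) λ b → x ≡ m b
      K-dangling-in : ∀ a x → delNode a ≡ true → edge G x (m a) ≡ true →
                      Σ (Fin (N p)) λ b → x ≡ m b

  -- p(G) = r ∨ ē G  (edges masked by the resulting node vector, which is
  -- a no-op whenever p is applicable)
  apply : (G : Graph T) → Match G → Graph T
  apply G μ = record { size = size G ; node = node' ; edge = edge' ; type = type G
                     ; edge-src = λ x y e → mask-l (raw x y) (node' x) (node' y) e
                     ; edge-tgt = λ x y e → mask-r (raw x y) (node' x) (node' y) e }
    where
    open Match μ
    is : Fin (N p) → Fin (size G) → Bool
    is a x = ⌊ m a ≟ x ⌋
    delG addG : Fin (size G) → Bool
    delG x = anyFin (λ a → is a x ∧ delNode a)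
    addG x = anyFin (λ a → is a x ∧ addNode a)
    eG rG : Fin (size G) → Fin (size G) → Bool
    eG x y = anyFin (λ a → anyFin (λ b → is a x ∧ (is b y ∧ delEdge a b)))
    rG x y = anyFin (λ a → anyFin (λ b → is a x ∧ (is b y ∧ addEdge a b)))
    node' : Fin (size G) → Bool
    node' x = addG x ∨ (not (delG x) ∧ node G x)
    raw : Fin (size G) → Fin (size G) → Bool
    raw x y = rG x y ∨ (not (eG x y) ∧ edge G x y)
    edge' : Fin (size G) → Fin (size G) → Bool
    edge' x y = raw x y ∧ (node' x ∧ node' y)

comatch : ∀ {T} (p : Production T) (G : Graph T) (μ : Match p G) → Match (inverse p) (apply p G μ)
comatch p G μ = record { m = Match.m μ ; m-inj = Match.m-inj μ ; m-typed = Match.m-typed μ }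

diagramGraphs : ∀ {T} (L K : Graph T) {e : ℕ} → (Fin e → Graph T) → Fin (2 + e) → Graph T
diagramGraphs L K others zero = L
diagramGraphs L K others (suc zero) = K
diagramGraphs L K others (suc (suc i)) = others i

record Condition {T : Set} (L K : Graph T) : Set where
  field
    extra : ℕ
    others : Fin extra → Graph T
    arrows : ℕ
    arrow : Fin arrows → Arrow (diagramGraphs L K others)
    commutes : Commutes (diagramGraphs L K others) arrow
    formula : Formula (2 + extra)
open Condition public

matchMap : ∀ {T} (A G : Graph T) (f : Fin (size A) → Fin (size G)) →
           (∀ a b → f a ≡ f b → a ≡ b) → (∀ a → type G (f a) ≡ type A a) → PMap A G
matchMap A G f inj typ = record { map = mm ; injective = mi ; typed = mt ; on-nodes = mo }
  where
  mm : Fin (size A) → Maybe (Fin (size G))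
  mm a = if node A a then just (f a) else nothing
  mi : ∀ a a' x → mm a ≡ just x → mm a' ≡ just x → a ≡ a'
  mi a a' x p q with node A a | node A a'
  ... | true | true = inj a a' (trans (just-inj p) (sym (just-inj q)))
  ... | false | _ with p
  ... | ()
  mi a a' x p q | true | false with q
  ... | ()
  mt : ∀ a x → mm a ≡ just x → type G x ≡ type A a
  mt a x p with node A a
  ... | true with p
  ... | refl = typ a
  mt a x p | false with p
  ... | ()
  mo : ∀ a x → mm a ≡ just x → node A a ≡ true
  mo a x p with node A a
  ... | true = refl
  mo a x p | false with p
  ... | ()

module _ {T : Set} where

  -- An application condition for q: a graph constraint with L(q) and K(q)
  -- in its diagram; its formula is  P(L,G) ∧ P(K,Ḡ) ∧ φ.
  AppCondition : Production T → Set
  AppCondition q = Condition (LHS q) (Nih q)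

  SatAC : (q : Production T) → AppCondition q → (G : Graph T) → Match q G → Set
  SatAC q C G μ =
    Applicable q G μ ×
    Semantics.⟦_⟧ (diagramGraphs (LHS q) (Nih q) (others C)) (arrow C) G
      (P zero host ∧F (P (suc zero) co ∧F formula C)) ρ₀
    where
    open Match μ
    Lm : PMap (LHS q) G
    Lm = matchMap (LHS q) G m m-inj m-typed
    Km : PMap (Nih q) G
    Km = matchMap (Nih q) G m m-inj m-typed
    ρ₀ : Semantics.Env (diagramGraphs (LHS q) (Nih q) (others C)) (arrow C) G
    ρ₀ zero = just Lm
    ρ₀ (suc zero) = just Km
    ρ₀ (suc (suc i)) = nothing

  Precondition : Production T → Set
  Precondition p = AppCondition p

  -- postcondition: set on the RHS (application condition of p⁻¹: contains
  -- R and the nihilation graph of p⁻¹), evaluated on p(G) with the comatch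
  Postcondition : Production T → Set
  Postcondition p = AppCondition (inverse p)

  SatPre : (p : Production T) → Precondition p → (G : Graph T) → Match p G → Set
  SatPre p C G μ = SatAC p C G μ

  SatPost : (p : Production T) → Postcondition p → (G : Graph T) → Match p G → Set
  SatPost p C G μ = SatAC (inverse p) C (apply p G μ) (comatch p G μ)

  ConsistentPre : (p : Production T) → Precondition p → Set
  ConsistentPre p C = Σ (Graph T) λ G → Σ (Match p G) λ μ → Applicable p G μ × SatPre p C G μ

  ConsistentPost : (p : Production T) → Postcondition p → Set
  ConsistentPost p C = Σ (Graph T) λ G → Σ (Match p G) λ μ → Applicable p G μ × SatPost p C G μ

  Equivalent : (p : Production T) → Precondition p → Postcondition p → Set
  Equivalent p pre post = ∀ (G : Graph T) (μ : Match p G) → Applicable p G μ →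
                          SatPre p pre G μ ⇔ SatPost p post G μ

module Submission where

-- Applying p at a match m changes only the node vector and the
-- adjacency matrix of the host graph G, and reversibly so: G is recovered
-- from p(G) by undoing p along m, and p(G) from G by undoing p⁻¹.  Partial
-- maps into G and into p(G) are literally the same objects, because both
-- graphs live on the same typed node universe.  Hence it suffices to show,
-- for an arbitrary production q and application condition C of q, that the
-- atoms P and Q of C — which only inspect nodes and edges of the host graph
-- H — can be expressed by a graph constraint for q⁻¹ evaluated on the graph
-- H' of which H is the undoing.  The translated diagram consists of R and K
-- of q⁻¹, a copy of every graph of C, and small witness graphs (a node, two
-- apart nodes, an edge, a loop) glued to the copies and to K by morphisms;
-- existential quantification over a witness expresses "z is mapped",
-- "z is mapped to m(c)", "the images of z, w are joined by an edge" in H',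
-- and a Boolean combination of these tests decides nodes and edges of H.
-- Quantifiers over graphs of C become quantifiers over their copies,
-- guarded by formulas expressing the commutation conditions.

open import Defs
open import Data.Product using (Σ; _×_; _,_; proj₁; proj₂)
open import Data.Nat as ℕ using (ℕ; zero; suc)
open import Data.Fin as F using (Fin; zero; suc; toℕ)
open import Data.Fin.Properties using (toℕ-injective; toℕ-fromℕ<; toℕ<n)
open import Data.Bool using (Bool; true; false; _∧_; _∨_; not; if_then_else_)
open import Data.Maybe using (Maybe; just; nothing; _>>=_)
open import Data.Sum using (_⊎_; inj₁; inj₂)
open import Data.Unit using (⊤; tt)
open import Data.Empty using (⊥; ⊥-elim)
open import Relation.Nullary using (¬_; yes; no; Dec)
open import Relation.Nullary.Decidable using (⌊_⌋)
open import Relation.Binary.PropositionalEquality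
open import Function.Bundles using (mk⇔; module Equivalence)
import Data.List as L
open import Data.List.Membership.Propositional using (_∈_)
open import Data.List.Membership.Propositional.Properties using (∈-map⁺; ∈-++⁺ˡ; ∈-++⁺ʳ; ∈-concatMap⁺; ∈-allFin)
import Data.List.Relation.Unary.Any as Any
open import Data.List.Relation.Unary.Any using (here; there)
open import Data.List.Relation.Unary.Any.Properties using (lookup-index)

infix 1 _↔_
_↔_ : Set → Set → Set
A ↔ B = (A → B) × (B → A)

bool-cases : ∀ b → (b ≡ true) ⊎ (b ≡ false)
bool-cases true = inj₁ refl
bool-cases false = inj₂ refl

∨-elim : ∀ a b → a ∨ b ≡ true → a ≡ true ⊎ b ≡ true
∨-elim true b _ = inj₁ refl
∨-elim false b h = inj₂ h

∨-introˡ : ∀ a b → a ≡ true → a ∨ b ≡ true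
∨-introˡ .true b refl = refl

∨-introʳ : ∀ a b → b ≡ true → a ∨ b ≡ true
∨-introʳ true b _ = refl
∨-introʳ false b h = h

∨-swap : ∀ a b → a ∨ b ≡ true → b ∨ a ≡ true
∨-swap a b h with ∨-elim a b h
... | inj₁ ha = ∨-introʳ b a ha
... | inj₂ hb = ∨-introˡ b a hb

∧-intro : ∀ {a b} → a ≡ true → b ≡ true → a ∧ b ≡ true
∧-intro refl refl = refl

∧3 : ∀ x y z → x ∧ (y ∧ z) ≡ true → (x ≡ true) × (y ≡ true) × (z ≡ true)
∧3 true true true _ = refl , refl , refl
∧3 true true false ()
∧3 true false _ ()
∧3 false _ _ ()

∧4 : ∀ x y z w → x ∧ (y ∧ (z ∧ w)) ≡ true → (x ≡ true) × (y ≡ true) × (z ≡ true) × (w ≡ true)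
∧4 true true true true _ = refl , refl , refl , refl
∧4 true true true false ()
∧4 true true false _ ()
∧4 true false _ _ ()
∧4 false _ _ _ ()

not-true→false : ∀ a → not a ≡ true → a ≡ false
not-true→false false _ = refl
not-true→false true ()

false→not-true : ∀ {a} → a ≡ false → not a ≡ true
false→not-true refl = refl

true≢false : ∀ {a} → a ≡ true → a ≡ false → ⊥
true≢false refl ()

¬true→false : ∀ {a} → ¬ (a ≡ true) → a ≡ false
¬true→false {true} h = ⊥-elim (h refl)
¬true→false {false} h = refl

bool-uip : ∀ {a b : Bool} (p q : a ≡ b) → p ≡ q
bool-uip refl refl = refl

nothing≢just : ∀ {A : Set} {x : A} → nothing ≡ just x → ⊥
nothing≢just ()

≟-sound : ∀ {n} (a b : Fin n) → ⌊ a F.≟ b ⌋ ≡ true → a ≡ b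
≟-sound a b h with a F.≟ b
... | yes e = e
... | no _ with h
... | ()

≟-complete : ∀ {n} (a b : Fin n) → a ≡ b → ⌊ a F.≟ b ⌋ ≡ true
≟-complete a b e with a F.≟ b
... | yes _ = refl
... | no ne = ⊥-elim (ne e)

≟-refl : ∀ {n} (i : Fin n) → ⌊ i F.≟ i ⌋ ≡ true
≟-refl i = ≟-complete i i refl

≟-refute : ∀ {n} (a b : Fin n) → ¬ a ≡ b → ⌊ a F.≟ b ⌋ ≡ false
≟-refute a b ne = ¬true→false (λ h → ne (≟-sound a b h))

eqN : ℕ → ℕ → Bool
eqN m n = ⌊ m ℕ.≟ n ⌋

eqN-sound : ∀ m n → eqN m n ≡ true → m ≡ n
eqN-sound m n h with m ℕ.≟ n
... | yes e = e
... | no _ with h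
... | ()

eqN-complete : ∀ m n → m ≡ n → eqN m n ≡ true
eqN-complete m n e with m ℕ.≟ n
... | yes _ = refl
... | no ne = ⊥-elim (ne e)

eqN-refute : ∀ m n → ¬ m ≡ n → eqN m n ≡ false
eqN-refute m n ne = ¬true→false (λ h → ne (eqN-sound m n h))

anyFin-witness : ∀ {n} (f : Fin n → Bool) → anyFin f ≡ true → Σ (Fin n) λ c → f c ≡ true
anyFin-witness {zero} f ()
anyFin-witness {suc n} f h with ∨-elim (f zero) _ h
... | inj₁ e = zero , e
... | inj₂ e with anyFin-witness (λ i → f (suc i)) e
... | c , e' = suc c , e'

anyFin-intro : ∀ {n} (f : Fin n → Bool) c → f c ≡ true → anyFin f ≡ true
anyFin-intro f zero h = ∨-introˡ _ _ h
anyFin-intro f (suc c) h = ∨-introʳ (f zero) _ (anyFin-intro (λ i → f (suc i)) c h)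

-- Images of node and edge predicates of a production under a node map m.
-- The Boolean formulas are exactly those used by the definition of apply.
module Img {N n : ℕ} (m : Fin N → Fin n) where
  Img : (Fin N → Bool) → Fin n → Set
  Img Pr x = Σ (Fin N) λ a → (m a ≡ x) × (Pr a ≡ true)

  Img2 : (Fin N → Fin N → Bool) → Fin n → Fin n → Set
  Img2 Pr x y = Σ (Fin N) λ a → Σ (Fin N) λ b → (m a ≡ x) × (m b ≡ y) × (Pr a b ≡ true)

  img-sound : ∀ Pr x → anyFin (λ a → ⌊ m a F.≟ x ⌋ ∧ Pr a) ≡ true → Img Pr x
  img-sound Pr x h with anyFin-witness _ h
  ... | a , e = a , ≟-sound (m a) x (∧-l _ _ e) , ∧-r _ _ e

  img-complete : ∀ Pr x → Img Pr x → anyFin (λ a → ⌊ m a F.≟ x ⌋ ∧ Pr a) ≡ true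
  img-complete Pr x (a , e , pa) = anyFin-intro _ a (∧-intro (≟-complete (m a) x e) pa)

  img2-sound : ∀ Pr x y → anyFin (λ a → anyFin (λ b → ⌊ m a F.≟ x ⌋ ∧ (⌊ m b F.≟ y ⌋ ∧ Pr a b))) ≡ true →
               Img2 Pr x y
  img2-sound Pr x y h with anyFin-witness _ h
  ... | a , e with anyFin-witness _ e
  ... | b , e' with ∧3 ⌊ m a F.≟ x ⌋ ⌊ m b F.≟ y ⌋ (Pr a b) e'
  ... | ea , eb , pab = a , b , ≟-sound (m a) x ea , ≟-sound (m b) y eb , pab

  img2-complete : ∀ Pr x y → Img2 Pr x y →
                  anyFin (λ a → anyFin (λ b → ⌊ m a F.≟ x ⌋ ∧ (⌊ m b F.≟ y ⌋ ∧ Pr a b))) ≡ true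
  img2-complete Pr x y (a , b , ea , eb , pab) =
    anyFin-intro _ a (anyFin-intro _ b (∧-intro (≟-complete (m a) x ea) (∧-intro (≟-complete (m b) y eb) pab)))

  img-absent : ∀ Pr x → ¬ Img Pr x → anyFin (λ a → ⌊ m a F.≟ x ⌋ ∧ Pr a) ≡ false
  img-absent Pr x h = ¬true→false (λ e → h (img-sound Pr x e))

  img2-absent : ∀ Pr x y → ¬ Img2 Pr x y →
                anyFin (λ a → anyFin (λ b → ⌊ m a F.≟ x ⌋ ∧ (⌊ m b F.≟ y ⌋ ∧ Pr a b))) ≡ false
  img2-absent Pr x y h = ¬true→false (λ e → h (img2-sound Pr x y e))

  img-dec : ∀ Pr x → Img Pr x ⊎ ¬ Img Pr x
  img-dec Pr x with bool-cases (anyFin (λ a → ⌊ m a F.≟ x ⌋ ∧ Pr a))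
  ... | inj₁ e = inj₁ (img-sound Pr x e)
  ... | inj₂ e = inj₂ (λ i → true≢false (img-complete Pr x i) e)

  img2-dec : ∀ Pr x y → Img2 Pr x y ⊎ ¬ Img2 Pr x y
  img2-dec Pr x y with bool-cases (anyFin (λ a → anyFin (λ b → ⌊ m a F.≟ x ⌋ ∧ (⌊ m b F.≟ y ⌋ ∧ Pr a b))))
  ... | inj₁ e = inj₁ (img2-sound Pr x y e)
  ... | inj₂ e = inj₂ (λ i → true≢false (img2-complete Pr x y i) e)

-- First index satisfying a Boolean test.  Morphisms of the translated
-- diagram are defined as "the unique b related to a", found by findFin.
findFin : ∀ {n} → (Fin n → Bool) → Maybe (Fin n)
findFin {zero} f = nothing
findFin {suc n} f = if f zero then just zero else Data.Maybe.map suc (findFin (λ i → f (suc i)))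
  where import Data.Maybe

find-sound : ∀ {n} (f : Fin n → Bool) b → findFin f ≡ just b → f b ≡ true
find-sound {suc n} f b h with f zero in e
find-sound {suc n} f zero refl | true = e
find-sound {suc n} f b h | false with findFin (λ i → f (suc i)) in e'
find-sound {suc n} f (suc b) refl | false | just b' = find-sound (λ i → f (suc i)) b e'
find-sound {suc n} f b () | false | nothing

find-complete : ∀ {n} (f : Fin n → Bool) b → f b ≡ true → Σ (Fin n) λ b' → findFin f ≡ just b'
find-complete {suc n} f b h with f zero in e0
... | true = zero , refl
... | false = go b h
  where
  import Data.Maybe
  go : ∀ b → f b ≡ true → Σ (Fin (suc n)) λ b' → Data.Maybe.map suc (findFin (λ i → f (suc i))) ≡ just b'
  go zero h' = ⊥-elim (true≢false h' e0)
  go (suc b) h' with find-complete (λ i → f (suc i)) b h'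
  ... | b' , e rewrite e = suc b' , refl

find-unique : ∀ {n} (f : Fin n → Bool) b → f b ≡ true → (∀ b' → f b' ≡ true → b' ≡ b) → findFin f ≡ just b
find-unique f b h u with find-complete f b h
... | b' , e = trans e (cong just (u b' (find-sound f b' e)))

-- Positions in lists; the extra graphs of the translated diagram are
-- indexed by positions in an exhaustive list of "slots".

∈-concatMap : ∀ {A B : Set} (f : A → L.List B) {y : B} {xs : L.List A} {x : A} →
              x ∈ xs → y ∈ f x → y ∈ L.concatMap f xs
∈-concatMap f {y} xs∈ h = ∈-concatMap⁺ f (Any.map (λ {x'} e → subst (λ z → y ∈ f z) e h) xs∈)

position : ∀ {A : Set} {x : A} {xs : L.List A} → x ∈ xs → Fin (L.length xs)
position = Any.index

lookup-position : ∀ {A : Set} {x : A} {xs : L.List A} (p : x ∈ xs) → L.lookup xs (position p) ≡ x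
lookup-position p = sym (lookup-index p)

-- Node presence read off a natural-number coordinate; relations between
-- graphs of different sizes are stated on ℕ to avoid casts between Fin types.
nodeℕ : ∀ {T : Set} → Graph T → ℕ → Bool
nodeℕ A n = anyFin (λ a → eqN (toℕ a) n ∧ node A a)

nodeℕ-sound : ∀ {T : Set} (A : Graph T) a → nodeℕ A (toℕ a) ≡ true → node A a ≡ true
nodeℕ-sound A a h with anyFin-witness _ h
... | a' , e with toℕ-injective {i = a'} {j = a} (eqN-sound _ _ (∧-l _ _ e))
... | refl = ∧-r (eqN (toℕ a') (toℕ a')) _ e

nodeℕ-complete : ∀ {T : Set} (A : Graph T) a → node A a ≡ true → nodeℕ A (toℕ a) ≡ true
nodeℕ-complete A a h = anyFin-intro _ a (∧-intro (eqN-complete _ _ refl) h)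

module _ {T : Set} (q : Production T) {n : ℕ} (m : Fin (N q) → Fin n) where
  open Img m

  UndoesNodes : (nH nH' : Fin n → Bool) → Set
  UndoesNodes nH nH' = ∀ x → (nH x ≡ true) ↔ (((nH' x ≡ true) × ¬ Img (addNode q) x) ⊎ Img (delNode q) x)

  UndoesEdges : (eH eH' : Fin n → Fin n → Bool) → Set
  UndoesEdges eH eH' = ∀ x y → (eH x y ≡ true) ↔
                        (((eH' x y ≡ true) × ¬ Img2 (addEdge q) x y) ⊎ Img2 (delEdge q) x y)

-- Its two outcomes are
-- symmetric: G is the undoing of p on p(G), p(G) is the undoing of p⁻¹ on
-- G, and p⁻¹ is applicable to p(G) at the comatch.
module Application {T : Set} (p : Production T) (G : Graph T) (μ : Match p G) (ap : Applicable p G μ) where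
  open Match μ
  open Applicable ap
  open Img m

  pG : Graph T
  pG = apply p G μ

  node-pG : ∀ x → (node pG x ≡ true) ↔ (Img (addNode p) x ⊎ ((¬ Img (delNode p) x) × (node G x ≡ true)))
  proj₁ (node-pG x) h with ∨-elim (anyFin (λ a → ⌊ m a F.≟ x ⌋ ∧ addNode p a)) _ h
  ... | inj₁ e = inj₁ (img-sound (addNode p) x e)
  ... | inj₂ e = inj₂ ((λ i → true≢false (img-complete _ x i) (not-true→false _ (∧-l _ _ e))) , ∧-r (not (anyFin (λ a → ⌊ m a F.≟ x ⌋ ∧ delNode p a))) _ e)
  proj₂ (node-pG x) (inj₁ i) = ∨-introˡ _ _ (img-complete _ x i)
  proj₂ (node-pG x) (inj₂ (ni , nG)) = ∨-introʳ (anyFin (λ a → ⌊ m a F.≟ x ⌋ ∧ addNode p a)) _ (∧-intro (false→not-true (img-absent _ x ni)) nG)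

  img-at-match : ∀ Pr a → Img Pr (m a) → Pr a ≡ true
  img-at-match Pr a (a' , e , pa) with m-inj a' a e
  ... | refl = pa

  img2-at-match : ∀ Pr a b → Img2 Pr (m a) (m b) → Pr a b ≡ true
  img2-at-match Pr a b (a' , b' , e , e' , pa) with m-inj a' a e | m-inj b' b e'
  ... | refl | refl = pa

  kept-not-deleted : ∀ a → VR p a ≡ true → delNode p a ≡ false
  kept-not-deleted a e rewrite e with VL p a
  ... | true = refl
  ... | false = refl

  node-pG-match : ∀ a → VR p a ≡ true → node pG (m a) ≡ true
  node-pG-match a e with VL p a in eL
  ... | true = proj₂ (node-pG (m a)) (inj₂ ((λ i → true≢false (img-at-match _ a i) (kept-not-deleted a e)) , L-nodes a eL))
  ... | false = proj₂ (node-pG (m a)) (inj₁ (a , refl , ∧-intro e (false→not-true eL)))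

  nih-edge : ∀ a b → nihRaw p a b ≡ true → edge (Nih p) a b ≡ true
  nih-edge a b h = ∧-intro h (∧-intro (covered p a) (covered p b))

  -- An edge of G at a node deleted by p is deleted by p: otherwise it
  -- would be an edge of the nihilation graph K.
  out-edge-deleted : ∀ a b → delNode p a ≡ true → edge G (m a) (m b) ≡ true → delEdge p a b ≡ true
  out-edge-deleted a b da eg with ML p a b in eML | MR p a b in eMR
  ... | true | false = refl
  ... | true | true = ⊥-elim (true≢false (R-src p a b eMR) (VR-f da))
    where
    VR-f : delNode p a ≡ true → VR p a ≡ false
    VR-f d = not-true→false _ (∧-r (VL p a) _ d)
  ... | false | _ = ⊥-elim (true≢false eg (K-edges a b (nih-edge a b (∨-introʳ (addEdge p a b) _ (∧-intro (∨-introˡ (delNode p a) _ da) (false→not-true eML))))))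

  in-edge-deleted : ∀ a b → delNode p b ≡ true → edge G (m a) (m b) ≡ true → delEdge p a b ≡ true
  in-edge-deleted a b db eg with ML p a b in eML | MR p a b in eMR
  ... | true | false = refl
  ... | true | true = ⊥-elim (true≢false (R-tgt p a b eMR) (not-true→false _ (∧-r (VL p b) _ db)))
  ... | false | _ = ⊥-elim (true≢false eg (K-edges a b (nih-edge a b (∨-introʳ (addEdge p a b) _ (∧-intro (∨-introʳ (delNode p a) _ db) (false→not-true eML))))))

  -- The adjacency matrix of p(G), read pointwise; the masking by the new
  -- node vector is harmless because p has no dangling edges.
  edge-pG : ∀ x y → (edge pG x y ≡ true) ↔ (Img2 (addEdge p) x y ⊎ ((¬ Img2 (delEdge p) x y) × (edge G x y ≡ true)))
  proj₁ (edge-pG x y) h with ∨-elim (anyFin (λ a → anyFin (λ b → ⌊ m a F.≟ x ⌋ ∧ (⌊ m b F.≟ y ⌋ ∧ addEdge p a b)))) _ (∧-l _ _ h)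
  ... | inj₁ e = inj₁ (img2-sound (addEdge p) x y e)
  ... | inj₂ e = inj₂ ((λ i → true≢false (img2-complete _ x y i) (not-true→false _ (∧-l _ _ e))) ,
                        ∧-r (not (anyFin (λ a → anyFin (λ b → ⌊ m a F.≟ x ⌋ ∧ (⌊ m b F.≟ y ⌋ ∧ delEdge p a b))))) _ e)
  proj₂ (edge-pG x y) (inj₁ (a , b , refl , refl , ad)) =
    ∧-intro (∨-introˡ _ _ (img2-complete _ (m a) (m b) (a , b , refl , refl , ad)))
            (∧-intro (node-pG-match a (R-src p a b (∧-l _ _ ad))) (node-pG-match b (R-tgt p a b (∧-l _ _ ad))))
  proj₂ (edge-pG x y) (inj₂ (nd , eg)) =
    ∧-intro (∨-introʳ (anyFin (λ a → anyFin (λ b → ⌊ m a F.≟ x ⌋ ∧ (⌊ m b F.≟ y ⌋ ∧ addEdge p a b)))) _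
                      (∧-intro (false→not-true (img2-absent _ x y nd)) eg))
            (∧-intro (proj₂ (node-pG x) (inj₂ (nodelx , edge-src G x y eg)))
                     (proj₂ (node-pG y) (inj₂ (nodely , edge-tgt G x y eg))))
    where
    nodelx : ¬ Img (delNode p) x
    nodelx (a , refl , da) with K-dangling-out a y da eg
    ... | b , refl = nd (a , b , refl , refl , out-edge-deleted a b da eg)
    nodely : ¬ Img (delNode p) y
    nodely (b , refl , db) with K-dangling-in b x db eg
    ... | a , refl = nd (a , b , refl , refl , in-edge-deleted a b db eg)

  -- G is recovered from p(G) by undoing p (uses L ⊆ G and K ⊆ Ḡ).
  node-G-recovered : UndoesNodes p m (node G) (node pG)
  proj₁ (node-G-recovered x) h with img-dec (delNode p) x
  ... | inj₁ i = inj₂ i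
  ... | inj₂ ni = inj₁ (proj₂ (node-pG x) (inj₂ (ni , h)) , λ { (a , refl , ad) → true≢false h (K-nodes a ad) })
  proj₂ (node-G-recovered x) (inj₁ (h , na)) with proj₁ (node-pG x) h
  ... | inj₁ i = ⊥-elim (na i)
  ... | inj₂ (_ , g) = g
  proj₂ (node-G-recovered x) (inj₂ (a , refl , da)) = L-nodes a (∧-l _ _ da)

  edge-G-recovered : UndoesEdges p m (edge G) (edge pG)
  proj₁ (edge-G-recovered x y) h with img2-dec (delEdge p) x y
  ... | inj₁ i = inj₂ i
  ... | inj₂ ni = inj₁ (proj₂ (edge-pG x y) (inj₂ (ni , h)) ,
                        λ { (a , b , refl , refl , ad) → true≢false h (K-edges a b (nih-edge a b (∨-introˡ _ _ ad))) })
  proj₂ (edge-G-recovered x y) (inj₁ (h , na)) with proj₁ (edge-pG x y) h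
  ... | inj₁ i = ⊥-elim (na i)
  ... | inj₂ (_ , g) = g
  proj₂ (edge-G-recovered x y) (inj₂ (a , b , refl , refl , de)) = L-edges a b (∧-l _ _ de)

  node-pG-produced : UndoesNodes (inverse p) m (node pG) (node G)
  proj₁ (node-pG-produced x) h with proj₁ (node-pG x) h
  ... | inj₁ i = inj₂ i
  ... | inj₂ (ni , g) = inj₁ (g , ni)
  proj₂ (node-pG-produced x) (inj₁ (g , ni)) = proj₂ (node-pG x) (inj₂ (ni , g))
  proj₂ (node-pG-produced x) (inj₂ i) = proj₂ (node-pG x) (inj₁ i)

  edge-pG-produced : UndoesEdges (inverse p) m (edge pG) (edge G)
  proj₁ (edge-pG-produced x y) h with proj₁ (edge-pG x y) h
  ... | inj₁ i = inj₂ i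
  ... | inj₂ (ni , g) = inj₁ (g , ni)
  proj₂ (edge-pG-produced x y) (inj₁ (g , ni)) = proj₂ (edge-pG x y) (inj₂ (ni , g))
  proj₂ (edge-pG-produced x y) (inj₂ i) = proj₂ (edge-pG x y) (inj₁ i)

  R-edges-pG : ∀ a b → MR p a b ≡ true → edge pG (m a) (m b) ≡ true
  R-edges-pG a b e with ML p a b in eL
  ... | true = proj₂ (edge-pG (m a) (m b)) (inj₂ ((λ i → true≢false (img2-at-match _ a b i) (nd e eL)) , L-edges a b eL))
    where
    nd : MR p a b ≡ true → ML p a b ≡ true → delEdge p a b ≡ false
    nd eR eL' rewrite eR | eL' = refl
  ... | false = proj₂ (edge-pG (m a) (m b)) (inj₁ (a , b , refl , refl , ∧-intro e (false→not-true eL)))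
  -- The nihilation graph of p⁻¹ is matched in the complement of p(G):
  -- deleted nodes are gone, and so are deleted edges and edges at added
  -- nodes that p does not create.
  deleted-absent-pG : ∀ a → delNode p a ≡ true → node pG (m a) ≡ false
  deleted-absent-pG a d = ¬true→false λ h → case₁ (proj₁ (node-pG (m a)) h)
    where
    case₁ : Img (addNode p) (m a) ⊎ ((¬ Img (delNode p) (m a)) × (node G (m a) ≡ true)) → ⊥
    case₁ (inj₁ i) = true≢false (∧-l _ _ d) (not-true→false _ (∧-r (VR p a) _ (img-at-match _ a i)))
    case₁ (inj₂ (ni , _)) = ni (a , refl , d)
  nih⁻¹-absent-pG : ∀ a b → edge (Nih (inverse p)) a b ≡ true → edge pG (m a) (m b) ≡ false
  nih⁻¹-absent-pG a b h = ¬true→false λ eh → cs (∨-elim (delEdge p a b) _ (∧-l (nihRaw (inverse p) a b) _ h)) (proj₁ (edge-pG (m a) (m b)) eh)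
    where
    cs : (delEdge p a b ≡ true) ⊎ ((addNode p a ∨ addNode p b) ∧ not (MR p a b) ≡ true) →
         Img2 (addEdge p) (m a) (m b) ⊎ ((¬ Img2 (delEdge p) (m a) (m b)) × (edge G (m a) (m b) ≡ true)) → ⊥
    cs (inj₁ de) (inj₁ i) = true≢false (∧-l _ _ (img2-at-match _ a b i)) (not-true→false _ (∧-r (ML p a b) _ de))
    cs (inj₂ an) (inj₁ i) = true≢false (∧-l _ _ (img2-at-match _ a b i)) (not-true→false _ (∧-r (addNode p a ∨ addNode p b) _ an))
    cs (inj₁ de) (inj₂ (nd , _)) = nd (a , b , refl , refl , de)
    cs (inj₂ an) (inj₂ (_ , eg)) with ∨-elim (addNode p a) _ (∧-l _ _ an)
    ... | inj₁ aa = true≢false (edge-src G _ _ eg) (K-nodes a aa)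
    ... | inj₂ ab = true≢false (edge-tgt G _ _ eg) (K-nodes b ab)
  added-dangling-out : ∀ a x → addNode p a ≡ true → edge pG (m a) x ≡ true → Σ (Fin (N p)) λ b → x ≡ m b
  added-dangling-out a x ad eh with proj₁ (edge-pG (m a) x) eh
  ... | inj₁ (_ , b , _ , e , _) = b , sym e
  ... | inj₂ (_ , eg) = ⊥-elim (true≢false (edge-src G _ _ eg) (K-nodes a ad))
  added-dangling-in : ∀ a x → addNode p a ≡ true → edge pG x (m a) ≡ true → Σ (Fin (N p)) λ b → x ≡ m b
  added-dangling-in a x ad eh with proj₁ (edge-pG x (m a)) eh
  ... | inj₁ (b , _ , e , _ , _) = b , sym e
  ... | inj₂ (_ , eg) = ⊥-elim (true≢false (edge-tgt G _ _ eg) (K-nodes a ad))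

  inverse-applicable : Applicable (inverse p) pG (comatch p G μ)
  inverse-applicable = record
    { L-nodes = node-pG-match
    ; L-edges = R-edges-pG
    ; K-nodes = deleted-absent-pG
    ; K-edges = nih⁻¹-absent-pG
    ; K-dangling-out = added-dangling-out
    ; K-dangling-in = added-dangling-in }

module _ {T : Set} (A G : Graph T) (f : Fin (size A) → Fin (size G))
         (inj : ∀ a b → f a ≡ f b → a ≡ b) (typ : ∀ a → type G (f a) ≡ type A a) where
  matchMap-defined : ∀ a → node A a ≡ true → map (matchMap A G f inj typ) a ≡ just (f a)
  matchMap-defined a e with node A a
  matchMap-defined a refl | true = refl

  matchMap-inverse : ∀ a x → map (matchMap A G f inj typ) a ≡ just x → (node A a ≡ true) × (f a ≡ x)
  matchMap-inverse a x e with node A a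
  matchMap-inverse a x refl | true = refl , refl
  matchMap-inverse a x () | false

  matchMap-undefined : ∀ a → node A a ≡ false → map (matchMap A G f inj typ) a ≡ nothing
  matchMap-undefined a e with node A a
  matchMap-undefined a refl | false = refl

module MatchAtoms {T : Set} (q : Production T) (G : Graph T) (μ : Match q G) (ap : Applicable q G μ)
                  {k : ℕ} (D : Fin k → Graph T) {na : ℕ} (arr : Fin na → Arrow D) where
  open Match μ
  open Applicable ap
  open Semantics D arr G

  L-total : Total (matchMap (LHS q) G m m-inj m-typed) host
  proj₁ L-total a e = m a , matchMap-defined (LHS q) G m m-inj m-typed a e , L-nodes a e
  proj₂ L-total a b x y e ex ey
    with matchMap-inverse (LHS q) G m m-inj m-typed a x ex | matchMap-inverse (LHS q) G m m-inj m-typed b y ey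
  ... | _ , refl | _ , refl = L-edges a b e

  K-total-co : Total (matchMap (Nih q) G m m-inj m-typed) co
  proj₁ K-total-co a e = m a , matchMap-defined (Nih q) G m m-inj m-typed a e , tt
  proj₂ K-total-co a b x y e ex ey
    with matchMap-inverse (Nih q) G m m-inj m-typed a x ex | matchMap-inverse (Nih q) G m m-inj m-typed b y ey
  ... | _ , refl | _ , refl = false→not-true (K-edges a b e)

module UpdateLemmas {T : Set} {k : ℕ} (D : Fin k → Graph T) {na : ℕ} (arr : Fin na → Arrow D) (G : Graph T) where
  open Semantics D arr G

  update-same : ∀ ρ i μ → update ρ i μ i ≡ just μ
  update-same ρ i μ with i F.≟ i
  ... | yes refl = refl
  ... | no ne = ⊥-elim (ne refl)

  update-other : ∀ ρ i μ j → ¬ i ≡ j → update ρ i μ j ≡ ρ j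
  update-other ρ i μ j ne with i F.≟ j
  ... | yes e = ⊥-elim (ne e)
  ... | no _ = refl

module SmallGraphs {T : Set} where
  emptyGraph : Graph T
  emptyGraph = record { size = 0 ; node = λ () ; edge = λ () ; type = λ () ; edge-src = λ () ; edge-tgt = λ () }

  oneNode : T → Bool → Graph T
  oneNode t b = record { size = 1 ; node = λ _ → true ; edge = λ _ _ → b ; type = λ _ → t
                  ; edge-src = λ _ _ _ → refl ; edge-tgt = λ _ _ _ → refl }

  edge01 : Bool → Fin 2 → Fin 2 → Bool
  edge01 b zero (suc zero) = b
  edge01 b _ _ = false

  types01 : T → T → Fin 2 → T
  types01 t1 t2' zero = t1
  types01 t1 t2' (suc _) = t2'

  twoNodes : T → T → Bool → Graph T
  twoNodes t1 t2' b = record { size = 2 ; node = λ _ → true ; edge = edge01 b ; type = types01 t1 t2'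
                       ; edge-src = λ _ _ _ → refl ; edge-tgt = λ _ _ _ → refl }
open SmallGraphs public

record IsMorphismRel {T : Set} (A B : Graph T) (R : ℕ → ℕ → Bool) : Set where
  constructor is-morphism-rel
  field
    functional : ∀ n m m' → R n m ≡ true → R n m' ≡ true → m ≡ m'
    rel-injective : ∀ n n' m → R n m ≡ true → R n' m ≡ true → n ≡ n'
    from-nodes : ∀ (a : Fin (size A)) m → R (toℕ a) m ≡ true → node A a ≡ true
    to-nodes : ∀ n (b : Fin (size B)) → R n (toℕ b) ≡ true → node B b ≡ true
    rel-typed : ∀ a b → R (toℕ a) (toℕ b) ≡ true → type B b ≡ type A a
open IsMorphismRel

empty-rel : ∀ {T} {A B : Graph T} → IsMorphismRel A B (λ _ _ → false)
empty-rel = is-morphism-rel (λ _ _ _ ()) (λ _ _ _ ()) (λ _ _ ()) (λ _ _ ()) (λ _ _ ())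

idRel : ∀ {T} → Graph T → ℕ → ℕ → Bool
idRel B n m = eqN n m ∧ nodeℕ B m

idRel-sound : ∀ {T} (B : Graph T) n m → idRel B n m ≡ true → (n ≡ m) × (nodeℕ B m ≡ true)
idRel-sound B n m h = eqN-sound _ _ (∧-l _ _ h) , ∧-r (eqN n m) _ h

idRel-ok : ∀ {T} (A B : Graph T) →
           (∀ (a : Fin (size A)) (b : Fin (size B)) → toℕ a ≡ toℕ b → type B b ≡ type A a) →
           (∀ (a : Fin (size A)) (b : Fin (size B)) → toℕ a ≡ toℕ b → node B b ≡ true → node A a ≡ true) →
           IsMorphismRel A B (idRel B)
idRel-ok A B same-type covers = is-morphism-rel fun inj from to typ
  where
  E : ∀ n m → idRel B n m ≡ true → (n ≡ m) × (nodeℕ B m ≡ true)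
  E = idRel-sound B
  fun : ∀ n m m' → idRel B n m ≡ true → idRel B n m' ≡ true → m ≡ m'
  fun n m m' h h' = trans (sym (proj₁ (E n m h))) (proj₁ (E n m' h'))
  inj : ∀ n n' m → idRel B n m ≡ true → idRel B n' m ≡ true → n ≡ n'
  inj n n' m h h' = trans (proj₁ (E n m h)) (sym (proj₁ (E n' m h')))
  to : ∀ n (b : Fin (size B)) → idRel B n (toℕ b) ≡ true → node B b ≡ true
  to n b h = nodeℕ-sound B b (proj₂ (E n _ h))
  from : ∀ (a : Fin (size A)) m → idRel B (toℕ a) m ≡ true → node A a ≡ true
  from a m h with E (toℕ a) m h
  ... | refl , nd with anyFin-witness _ nd
  ... | b , e = covers a b (sym (eqN-sound _ _ (∧-l _ _ e))) (∧-r (eqN (toℕ b) (toℕ a)) _ e)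
  typ : ∀ a b → idRel B (toℕ a) (toℕ b) ≡ true → type B b ≡ type A a
  typ a b h = same-type a b (proj₁ (E _ _ h))

fin2-0 : (b : Fin 2) → toℕ b ≡ 0 → b ≡ zero
fin2-0 zero _ = refl
fin2-0 (suc _) ()

fin2-1 : (b : Fin 2) → toℕ b ≡ 1 → b ≡ suc zero
fin2-1 zero ()
fin2-1 (suc zero) _ = refl

fin1 : (b : Fin 1) → b ≡ zero
fin1 zero = refl

module _ {T : Set} (G : Graph T) where
  pointMap : ∀ {t} b (x : Fin (size G)) → type G x ≡ t → PMap (oneNode t b) G
  pointMap b x tx = record { map = λ _ → just x ; injective = λ a a' _ _ _ → trans (fin1 a) (sym (fin1 a'))
                           ; typed = λ a y e → trans (cong (type G) (sym (just-inj e))) tx ; on-nodes = λ _ _ _ → refl }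

  pairMap-map : (x y : Fin (size G)) → Fin 2 → Maybe (Fin (size G))
  pairMap-map x y zero = just x
  pairMap-map x y (suc _) = just y

  pairMap : ∀ {t t'} b (x y : Fin (size G)) → ¬ x ≡ y → type G x ≡ t → type G y ≡ t' → PMap (twoNodes t t' b) G
  pairMap {t} {t'} b x y nxy tx ty = record { map = pairMap-map x y ; injective = inj ; typed = tp ; on-nodes = λ _ _ _ → refl }
    where
    inj : ∀ a a' v → pairMap-map x y a ≡ just v → pairMap-map x y a' ≡ just v → a ≡ a'
    inj zero zero v _ _ = refl
    inj zero (suc zero) v e e' = ⊥-elim (nxy (trans (just-inj e) (sym (just-inj e'))))
    inj (suc zero) zero v e e' = ⊥-elim (nxy (trans (just-inj e') (sym (just-inj e))))
    inj (suc zero) (suc zero) v _ _ = refl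
    tp : ∀ a v → pairMap-map x y a ≡ just v → type G v ≡ types01 t t' a
    tp zero v e = trans (cong (type G) (sym (just-inj e))) tx
    tp (suc zero) v e = trans (cong (type G) (sym (just-inj e))) ty

-- The new diagram has R, K of q⁻¹ at positions 0, 1 and one further
-- graph for each "slot":
--   copy i           a copy of the i-th graph of C;
--   arrowWit j       a copy of the target of the j-th arrow of C, glued to
--                    the copies of its source (via the arrow) and target;
--                    it exists compatibly iff the arrow commutes;
--   matchL, matchK   L and K of q glued to K of q⁻¹ and to copies 0 and 1;
--                    they pin those copies to the match;
--   nodeWit i z      one node, glued to node z of copy i ("z is mapped");
--   apartWit i z c   two nodes glued to z and to node c of K ("z ↦ x ≠ m c");
--   edgeWit i z w    an edge glued to z and w ("edge between their images");
--   loopWit i z      a loop glued to z.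
-- Arrows go from sources (K and the copies) to sinks (all other slots), so
-- every path has length at most one and the diagram commutes trivially.
module Translation {T : Set} (q : Production T) (C : Condition (LHS q) (Nih q)) where
  NN : ℕ
  NN = N q
  k : ℕ
  k = 2 ℕ.+ extra C
  Src : Fin k → Graph T
  Src = diagramGraphs (LHS q) (Nih q) (others C)
  na : ℕ
  na = arrows C
  srcArrow : Fin na → Arrow Src
  srcArrow = arrow C
  L⁻¹ K⁻¹ : Graph T
  L⁻¹ = LHS (inverse q)
  K⁻¹ = Nih (inverse q)

  data Slot : Set where
    copy : Fin k → Slot
    arrowWit : Fin na → Slot
    matchL matchK : Slot
    nodeWit : (i : Fin k) → Fin (size (Src i)) → Slot
    apartWit : (i : Fin k) → Fin (size (Src i)) → Fin NN → Slot
    edgeWit : (i : Fin k) → Fin (size (Src i)) → Fin (size (Src i)) → Slot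
    loopWit : (i : Fin k) → Fin (size (Src i)) → Slot

  abstract
    every : ∀ {A : Set} n → (Fin n → L.List A) → L.List A
    every n f = L.concatMap f (L.allFin n)

    ∈-every : ∀ {A : Set} n (f : Fin n → L.List A) (i : Fin n) {y : A} → y ∈ f i → y ∈ every n f
    ∈-every n f i h = ∈-concatMap f (∈-allFin i) h

    slotsAt : (i : Fin k) → L.List Slot
    slotsAt i = copy i L.∷ every (size (Src i)) λ z →
                  nodeWit i z L.∷ loopWit i z L.∷
                  (every NN (λ c → apartWit i z c L.∷ L.[]) L.++ every (size (Src i)) (λ w → edgeWit i z w L.∷ L.[]))

    allSlots : L.List Slot
    allSlots = matchL L.∷ matchK L.∷ (every na (λ j → arrowWit j L.∷ L.[]) L.++ every k slotsAt)

    at-node : ∀ i z {d} → d ∈ (nodeWit i z L.∷ loopWit i z L.∷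
                                (every NN (λ c → apartWit i z c L.∷ L.[]) L.++
                                 every (size (Src i)) (λ w → edgeWit i z w L.∷ L.[]))) → d ∈ allSlots
    at-node i z h = there (there (∈-++⁺ʳ _ (∈-every k slotsAt i (there (∈-every _ _ z h)))))

    slot-listed : ∀ d → d ∈ allSlots
    slot-listed matchL = here refl
    slot-listed matchK = there (here refl)
    slot-listed (arrowWit j) = there (there (∈-++⁺ˡ (∈-every na _ j (here refl))))
    slot-listed (copy i) = there (there (∈-++⁺ʳ _ (∈-every k slotsAt i (here refl))))
    slot-listed (nodeWit i z) = at-node i z (here refl)
    slot-listed (loopWit i z) = at-node i z (there (here refl))
    slot-listed (apartWit i z c) = at-node i z (there (there (∈-++⁺ˡ (∈-every NN _ c (here refl)))))
    slot-listed (edgeWit i z w) = at-node i z (there (there (∈-++⁺ʳ _ (∈-every _ _ w (here refl)))))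

  e' : ℕ
  e' = L.length allSlots
  k' : ℕ
  k' = 2 ℕ.+ e'

  slotIndex : Slot → Fin e'
  slotIndex d = position (slot-listed d)

  -- A position is used only if
  -- it is the canonical index of its slot, so that position and slot
  -- determine each other without proving the list duplicate-free.
  data Entry : Set where
    entryR entryK unused : Entry
    slot : Slot → Entry

  entryAt : Fin e' → Slot → Entry
  entryAt y d = if ⌊ slotIndex d F.≟ y ⌋ then slot d else unused

  entry : Fin k' → Entry
  entry zero = entryR
  entry (suc zero) = entryK
  entry (suc (suc y)) = entryAt y (L.lookup allSlots y)

  slotGraph : Slot → Graph T
  slotGraph (copy i) = Src i
  slotGraph (arrowWit j) = Src (tgt (srcArrow j))
  slotGraph matchL = LHS q
  slotGraph matchK = Nih q
  slotGraph (nodeWit i z) = oneNode (type (Src i) z) false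
  slotGraph (apartWit i z c) = twoNodes (type (Src i) z) (ty q c) false
  slotGraph (edgeWit i z w) = twoNodes (type (Src i) z) (type (Src i) w) true
  slotGraph (loopWit i z) = oneNode (type (Src i) z) true

  entryGraph : Entry → Graph T
  entryGraph entryR = L⁻¹
  entryGraph entryK = K⁻¹
  entryGraph unused = emptyGraph
  entryGraph (slot d) = slotGraph d

  newOthers : Fin e' → Graph T
  newOthers y = entryGraph (entryAt y (L.lookup allSlots y))

  Tgt : Fin k' → Graph T
  Tgt = diagramGraphs L⁻¹ K⁻¹ newOthers

  place : Slot → Fin k'
  place d = suc (suc (slotIndex d))

  entry-place : ∀ d → entry (place d) ≡ slot d
  entry-place d rewrite lookup-position (slot-listed d) | ≟-refl (slotIndex d) = refl

  place-entry : ∀ s d → entry s ≡ slot d → s ≡ place d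
  place-entry zero d ()
  place-entry (suc zero) d ()
  place-entry (suc (suc y)) d h with ⌊ slotIndex (L.lookup allSlots y) F.≟ y ⌋ in e
  place-entry (suc (suc y)) d refl | true = cong (λ z → suc (suc z)) (sym (≟-sound _ _ e))
  place-entry (suc (suc y)) d () | false

  entry-K : ∀ s → entry s ≡ entryK → s ≡ suc zero
  entry-K zero ()
  entry-K (suc zero) _ = refl
  entry-K (suc (suc y)) h with ⌊ slotIndex (L.lookup allSlots y) F.≟ y ⌋
  entry-K (suc (suc y)) () | true
  entry-K (suc (suc y)) () | false

  Tgt-place : ∀ d → Tgt (place d) ≡ slotGraph d
  Tgt-place d = cong entryGraph (entry-place d)

  isSource : Entry → Bool
  isSource entryK = true
  isSource (slot (copy _)) = true
  isSource _ = false

  isSink : Entry → Bool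
  isSink (slot (copy _)) = false
  isSink (slot _) = true
  isSink _ = false

  not-source-and-sink : ∀ X → isSource X ≡ true → isSink X ≡ true → ⊥
  not-source-and-sink entryK _ ()
  not-source-and-sink (slot (copy _)) _ ()
  not-source-and-sink entryR () _
  not-source-and-sink unused () _
  not-source-and-sink (slot (arrowWit _)) () _
  not-source-and-sink (slot matchL) () _
  not-source-and-sink (slot matchK) () _
  not-source-and-sink (slot (nodeWit _ _)) () _
  not-source-and-sink (slot (apartWit _ _ _)) () _
  not-source-and-sink (slot (edgeWit _ _ _)) () _
  not-source-and-sink (slot (loopWit _ _)) () _

  hasArrow : Fin k' → Fin k' → Bool
  hasArrow s t = isSource (entry s) ∧ isSink (entry t)

  hasArrow-distinct : ∀ s t → hasArrow s t ≡ true → ¬ s ≡ t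
  hasArrow-distinct s .s v refl = not-source-and-sink (entry s) (∧-l _ _ v) (∧-r (isSource (entry s)) _ v)

  mEq : ∀ {n} → Maybe (Fin n) → ℕ → Bool
  mEq (just x) m = eqN (toℕ x) m
  mEq nothing m = false

  arrowRel : Fin na → ℕ → ℕ → Bool
  arrowRel j n m = anyFin (λ a → eqN (toℕ a) n ∧ mEq (map (pmap (mor (srcArrow j))) a) m)

  arrowRel-sound : ∀ j n m → arrowRel j n m ≡ true →
                   Σ (Fin (size (Src (src (srcArrow j))))) λ a → (toℕ a ≡ n) ×
                   Σ (Fin (size (Src (tgt (srcArrow j))))) λ x → (map (pmap (mor (srcArrow j))) a ≡ just x) × (toℕ x ≡ m)
  arrowRel-sound j n m h with anyFin-witness _ h
  ... | a , e with map (pmap (mor (srcArrow j))) a in em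
  ... | just x = a , eqN-sound _ _ (∧-l _ _ e) , x , em , eqN-sound _ _ (∧-r (eqN (toℕ a) n) _ e)
  ... | nothing = ⊥-elim (true≢false (∧-r (eqN (toℕ a) n) _ e) refl)

  relFromK : Slot → ℕ → ℕ → Bool
  relFromK (apartWit i z c) n m = eqN n (toℕ c) ∧ eqN m 1
  relFromK matchL n m = idRel (LHS q) n m
  relFromK matchK n m = idRel (Nih q) n m
  relFromK _ n m = false

  atNode : Fin k → Fin k → (z : ℕ) → ℕ → ℕ → Bool
  atNode i' i z n m = ⌊ i' F.≟ i ⌋ ∧ (nodeℕ (Src i') n ∧ (eqN n z ∧ eqN m 0))

  relFromCopy : Fin k → Slot → ℕ → ℕ → Bool
  relFromCopy i' (nodeWit i z) = atNode i' i (toℕ z)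
  relFromCopy i' (apartWit i z c) = atNode i' i (toℕ z)
  relFromCopy i' (loopWit i z) = atNode i' i (toℕ z)
  relFromCopy i' (edgeWit i z w) n m = ⌊ i' F.≟ i ⌋ ∧ (nodeℕ (Src i') n ∧
      ((eqN n (toℕ z) ∧ eqN m 0) ∨ (not (eqN n (toℕ z)) ∧ (eqN n (toℕ w) ∧ eqN m 1))))
  relFromCopy i' (arrowWit j) n m = not ⌊ src (srcArrow j) F.≟ tgt (srcArrow j) ⌋ ∧
      ((⌊ i' F.≟ src (srcArrow j) ⌋ ∧ arrowRel j n m) ∨
       (⌊ i' F.≟ tgt (srcArrow j) ⌋ ∧ idRel (Src (tgt (srcArrow j))) n m))
  relFromCopy i' matchL n m = ⌊ i' F.≟ zero ⌋ ∧ idRel (LHS q) n m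
  relFromCopy i' matchK n m = ⌊ i' F.≟ suc zero ⌋ ∧ idRel (Nih q) n m
  relFromCopy i' (copy _) n m = false

  entryRel : Entry → Entry → ℕ → ℕ → Bool
  entryRel entryK (slot d) n m = relFromK d n m
  entryRel (slot (copy i)) (slot d) n m = relFromCopy i d n m
  entryRel _ _ n m = false

  tgtRel : Fin k' → Fin k' → ℕ → ℕ → Bool
  tgtRel s t n m = if ⌊ s F.≟ t ⌋ then eqN n m else entryRel (entry s) (entry t) n m

  tgtMap : (s t : Fin k') → Fin (size (Tgt s)) → Maybe (Fin (size (Tgt t)))
  tgtMap s t a = findFin (λ b → tgtRel s t (toℕ a) (toℕ b))

  tgtRel-distinct : ∀ s t n m → ¬ s ≡ t → tgtRel s t n m ≡ entryRel (entry s) (entry t) n m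
  tgtRel-distinct s t n m ne with s F.≟ t
  ... | yes e = ⊥-elim (ne e)
  ... | no _ = refl

  tgtMap-refl : ∀ s a → tgtMap s s a ≡ just a
  tgtMap-refl s a = find-unique _ a h u
    where
    h : tgtRel s s (toℕ a) (toℕ a) ≡ true
    h rewrite ≟-refl s = eqN-complete _ _ refl
    u : ∀ b → tgtRel s s (toℕ a) (toℕ b) ≡ true → b ≡ a
    u b e rewrite ≟-refl s = sym (toℕ-injective (eqN-sound _ _ e))

  guard-sound : ∀ (i' i : Fin k) b → ⌊ i' F.≟ i ⌋ ∧ b ≡ true → (i' ≡ i) × (b ≡ true)
  guard-sound i' i b h = ≟-sound _ _ (∧-l _ _ h) , ∧-r ⌊ i' F.≟ i ⌋ b h

  atNode-sound : ∀ i' i z n m → atNode i' i z n m ≡ true →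
                 (i' ≡ i) × (nodeℕ (Src i') n ≡ true) × (n ≡ z) × (m ≡ 0)
  atNode-sound i' i z n m h with ∧4 ⌊ i' F.≟ i ⌋ (nodeℕ (Src i') n) (eqN n z) (eqN m 0) h
  ... | a , b , c , d = ≟-sound _ _ a , b , eqN-sound _ _ c , eqN-sound _ _ d

  edgeRel-sound : ∀ i' i z w n m → relFromCopy i' (edgeWit i z w) n m ≡ true →
                  (i' ≡ i) × (nodeℕ (Src i') n ≡ true) ×
                  (((n ≡ toℕ z) × (m ≡ 0)) ⊎ ((¬ n ≡ toℕ z) × (n ≡ toℕ w) × (m ≡ 1)))
  edgeRel-sound i' i z w n m h with ∧3 ⌊ i' F.≟ i ⌋ (nodeℕ (Src i') n) _ h
  ... | a , b , c = ≟-sound _ _ a , b , alt (∨-elim _ _ c)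
    where
    alt : ((eqN n (toℕ z) ∧ eqN m 0) ≡ true) ⊎ ((not (eqN n (toℕ z)) ∧ (eqN n (toℕ w) ∧ eqN m 1)) ≡ true) →
          ((n ≡ toℕ z) × (m ≡ 0)) ⊎ ((¬ n ≡ toℕ z) × (n ≡ toℕ w) × (m ≡ 1))
    alt (inj₁ x) = inj₁ (eqN-sound _ _ (∧-l _ _ x) , eqN-sound _ _ (∧-r (eqN n (toℕ z)) _ x))
    alt (inj₂ x) with ∧3 (not (eqN n (toℕ z))) (eqN n (toℕ w)) (eqN m 1) x
    ... | u , v , r = inj₂ ((λ e → true≢false (eqN-complete _ _ e) (not-true→false _ u)) , eqN-sound _ _ v , eqN-sound _ _ r)

  arrowWitRel-sound : ∀ i' j n m → relFromCopy i' (arrowWit j) n m ≡ true → (¬ src (srcArrow j) ≡ tgt (srcArrow j)) ×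
                      (((i' ≡ src (srcArrow j)) × (arrowRel j n m ≡ true)) ⊎
                       ((i' ≡ tgt (srcArrow j)) × (n ≡ m) × (nodeℕ (Src (tgt (srcArrow j))) m ≡ true)))
  arrowWitRel-sound i' j n m h =
    (λ e → true≢false (≟-complete _ _ e) (not-true→false _ (∧-l _ _ h))) ,
    alt (∨-elim _ _ (∧-r (not ⌊ src (srcArrow j) F.≟ tgt (srcArrow j) ⌋) _ h))
    where
    alt : ((⌊ i' F.≟ src (srcArrow j) ⌋ ∧ arrowRel j n m) ≡ true) ⊎
          ((⌊ i' F.≟ tgt (srcArrow j) ⌋ ∧ idRel (Src (tgt (srcArrow j))) n m) ≡ true) →
          ((i' ≡ src (srcArrow j)) × (arrowRel j n m ≡ true)) ⊎
          ((i' ≡ tgt (srcArrow j)) × (n ≡ m) × (nodeℕ (Src (tgt (srcArrow j))) m ≡ true))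
    alt (inj₁ x) = inj₁ (guard-sound _ _ _ x)
    alt (inj₂ x) with guard-sound _ _ _ x
    ... | e , r = inj₂ (e , idRel-sound (Src (tgt (srcArrow j))) n m r)

  covR : ∀ a → VR q a ∨ VL q a ≡ true
  covR a = ∨-swap (VL q a) (VR q a) (covered q a)

  universe-type : ∀ (a b : Fin NN) → toℕ a ≡ toℕ b → ty q b ≡ ty q a
  universe-type a b e rewrite toℕ-injective {i = a} {j = b} e = refl

  universe-node : ∀ (V : Fin NN → Bool) (a b : Fin NN) → toℕ a ≡ toℕ b → V b ≡ true → V a ≡ true
  universe-node V a b e h rewrite toℕ-injective {i = a} {j = b} e = h

  sameIdx : ∀ {i' i : Fin k} → i' ≡ i → (a : Fin (size (Src i'))) (z : Fin (size (Src i))) → toℕ a ≡ toℕ z →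
            (type (Src i) z ≡ type (Src i') a) × (node (Src i') a ≡ node (Src i) z)
  sameIdx refl a z h with toℕ-injective {i = a} {j = z} h
  ... | refl = refl , refl

  guarded-ok : ∀ (i₀ : Fin k) {B : Graph T} (R : ℕ → ℕ → Bool) → IsMorphismRel (Src i₀) B R →
               ∀ i' → IsMorphismRel (Src i') B (λ n m → ⌊ i' F.≟ i₀ ⌋ ∧ R n m)
  guarded-ok i₀ R ok i' with i' F.≟ i₀
  ... | yes refl = ok
  ... | no _ = empty-rel

  relFromK-ok : ∀ d → IsMorphismRel K⁻¹ (slotGraph d) (relFromK d)
  relFromK-ok (apartWit i z c) = is-morphism-rel fun inj (λ a m h → covR a) (λ n b h → refl) typ
    where
    E : ∀ n m → relFromK (apartWit i z c) n m ≡ true → (n ≡ toℕ c) × (m ≡ 1)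
    E n m h = eqN-sound _ _ (∧-l _ _ h) , eqN-sound _ _ (∧-r (eqN n (toℕ c)) _ h)
    fun : ∀ n m m' → relFromK (apartWit i z c) n m ≡ true → relFromK (apartWit i z c) n m' ≡ true → m ≡ m'
    fun n m m' h h' = trans (proj₂ (E n m h)) (sym (proj₂ (E n m' h')))
    inj : ∀ n n' m → relFromK (apartWit i z c) n m ≡ true → relFromK (apartWit i z c) n' m ≡ true → n ≡ n'
    inj n n' m h h' = trans (proj₁ (E n m h)) (sym (proj₁ (E n' m h')))
    typ : ∀ a b → relFromK (apartWit i z c) (toℕ a) (toℕ b) ≡ true → type (slotGraph (apartWit i z c)) b ≡ type K⁻¹ a
    typ a b h with fin2-1 b (proj₂ (E _ _ h)) | toℕ-injective {i = a} {j = c} (proj₁ (E _ _ h))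
    ... | refl | refl = refl
  relFromK-ok matchL = idRel-ok K⁻¹ (LHS q) universe-type (λ a _ _ _ → covR a)
  relFromK-ok matchK = idRel-ok K⁻¹ (Nih q) universe-type (λ a _ _ _ → covR a)
  relFromK-ok (copy _) = empty-rel
  relFromK-ok (arrowWit _) = empty-rel
  relFromK-ok (nodeWit _ _) = empty-rel
  relFromK-ok (edgeWit _ _ _) = empty-rel
  relFromK-ok (loopWit _ _) = empty-rel

  atNode-ok : ∀ i' i (z : Fin (size (Src i))) (B : Graph T) → (∀ b → node B b ≡ true) →
              (∀ (b : Fin (size B)) → toℕ b ≡ 0 → type B b ≡ type (Src i) z) →
              IsMorphismRel (Src i') B (atNode i' i (toℕ z))
  atNode-ok i' i z B all-nodes type0 = is-morphism-rel fun inj from (λ _ b _ → all-nodes b) typ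
    where
    E : ∀ n m → atNode i' i (toℕ z) n m ≡ true → (i' ≡ i) × (nodeℕ (Src i') n ≡ true) × (n ≡ toℕ z) × (m ≡ 0)
    E = atNode-sound i' i (toℕ z)
    fun : ∀ n m m' → atNode i' i (toℕ z) n m ≡ true → atNode i' i (toℕ z) n m' ≡ true → m ≡ m'
    fun n m m' h h' = trans (proj₂ (proj₂ (proj₂ (E n m h)))) (sym (proj₂ (proj₂ (proj₂ (E n m' h')))))
    inj : ∀ n n' m → atNode i' i (toℕ z) n m ≡ true → atNode i' i (toℕ z) n' m ≡ true → n ≡ n'
    inj n n' m h h' = trans (proj₁ (proj₂ (proj₂ (E n m h)))) (sym (proj₁ (proj₂ (proj₂ (E n' m h')))))
    from : ∀ (a : Fin (size (Src i'))) m → atNode i' i (toℕ z) (toℕ a) m ≡ true → node (Src i') a ≡ true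
    from a m h = nodeℕ-sound (Src i') a (proj₁ (proj₂ (E _ m h)))
    typ : ∀ a b → atNode i' i (toℕ z) (toℕ a) (toℕ b) ≡ true → type B b ≡ type (Src i') a
    typ a b h with E _ _ h
    ... | e , _ , ez , eb = trans (type0 b eb) (proj₁ (sameIdx e a z ez))

  edgeWit-ok : ∀ i' i z w → IsMorphismRel (Src i') (slotGraph (edgeWit i z w)) (relFromCopy i' (edgeWit i z w))
  edgeWit-ok i' i z w = is-morphism-rel fun inj from (λ n b h → refl) typ
    where
    R : ℕ → ℕ → Bool
    R = relFromCopy i' (edgeWit i z w)
    E : ∀ n m → R n m ≡ true → (i' ≡ i) × (nodeℕ (Src i') n ≡ true) ×
                               (((n ≡ toℕ z) × (m ≡ 0)) ⊎ ((¬ n ≡ toℕ z) × (n ≡ toℕ w) × (m ≡ 1)))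
    E = edgeRel-sound i' i z w
    0≢1 : ¬ (0 ≡ 1)
    0≢1 ()
    fun : ∀ n m m' → R n m ≡ true → R n m' ≡ true → m ≡ m'
    fun n m m' h h' with proj₂ (proj₂ (E n m h)) | proj₂ (proj₂ (E n m' h'))
    ... | inj₁ (_ , e₁) | inj₁ (_ , e₂) = trans e₁ (sym e₂)
    ... | inj₁ (ez , _) | inj₂ (nz , _) = ⊥-elim (nz ez)
    ... | inj₂ (nz , _) | inj₁ (ez , _) = ⊥-elim (nz ez)
    ... | inj₂ (_ , _ , e₁) | inj₂ (_ , _ , e₂) = trans e₁ (sym e₂)
    inj : ∀ n n' m → R n m ≡ true → R n' m ≡ true → n ≡ n'
    inj n n' m h h' with proj₂ (proj₂ (E n m h)) | proj₂ (proj₂ (E n' m h'))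
    ... | inj₁ (e₁ , _) | inj₁ (e₂ , _) = trans e₁ (sym e₂)
    ... | inj₁ (_ , x) | inj₂ (_ , _ , y) = ⊥-elim (0≢1 (trans (sym x) y))
    ... | inj₂ (_ , _ , y) | inj₁ (_ , x) = ⊥-elim (0≢1 (trans (sym x) y))
    ... | inj₂ (_ , e₁ , _) | inj₂ (_ , e₂ , _) = trans e₁ (sym e₂)
    from : ∀ (a : Fin (size (Src i'))) m → R (toℕ a) m ≡ true → node (Src i') a ≡ true
    from a m h = nodeℕ-sound (Src i') a (proj₁ (proj₂ (E _ m h)))
    typ : ∀ a b → R (toℕ a) (toℕ b) ≡ true → type (slotGraph (edgeWit i z w)) b ≡ type (Src i') a
    typ a b h with E _ _ h
    ... | ei , _ , inj₁ (ez , eb) with fin2-0 b eb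
    ... | refl = proj₁ (sameIdx ei a z ez)
    typ a b h | ei , _ , inj₂ (_ , ew , eb) with fin2-1 b eb
    ... | refl = proj₁ (sameIdx ei a w ew)

  module ArrowWitRel (i' : Fin k) (j : Fin na) where
    s0 t0 : Fin k
    s0 = src (srcArrow j)
    t0 = tgt (srcArrow j)
    f : PMor (Src s0) (Src t0)
    f = mor (srcArrow j)
    R : ℕ → ℕ → Bool
    R = relFromCopy i' (arrowWit j)
    E : ∀ n m → R n m ≡ true → (¬ s0 ≡ t0) ×
          (((i' ≡ s0) × (arrowRel j n m ≡ true)) ⊎ ((i' ≡ t0) × (n ≡ m) × (nodeℕ (Src t0) m ≡ true)))
    E = arrowWitRel-sound i' j
    fun : ∀ n m m' → R n m ≡ true → R n m' ≡ true → m ≡ m'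
    fun n m m' h h' with E n m h | E n m' h'
    ... | ne , inj₁ (e₁ , f₁) | _ , inj₂ (e₂ , _) = ⊥-elim (ne (trans (sym e₁) e₂))
    ... | ne , inj₂ (e₁ , _) | _ , inj₁ (e₂ , f₂) = ⊥-elim (ne (trans (sym e₂) e₁))
    ... | _ , inj₂ (_ , x , _) | _ , inj₂ (_ , y , _) = trans (sym x) y
    ... | _ , inj₁ (_ , f₁) | _ , inj₁ (_ , f₂) with arrowRel-sound j n m f₁ | arrowRel-sound j n m' f₂
    ... | a₁ , ea₁ , x₁ , mx₁ , tx₁ | a₂ , ea₂ , x₂ , mx₂ , tx₂ with toℕ-injective {i = a₁} {j = a₂} (trans ea₁ (sym ea₂))
    ... | refl with trans (sym mx₁) mx₂
    ... | refl = trans (sym tx₁) tx₂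
    inj : ∀ n n' m → R n m ≡ true → R n' m ≡ true → n ≡ n'
    inj n n' m h h' with E n m h | E n' m h'
    ... | ne , inj₁ (e₁ , f₁) | _ , inj₂ (e₂ , _) = ⊥-elim (ne (trans (sym e₁) e₂))
    ... | ne , inj₂ (e₁ , _) | _ , inj₁ (e₂ , f₂) = ⊥-elim (ne (trans (sym e₂) e₁))
    ... | _ , inj₂ (_ , x , _) | _ , inj₂ (_ , y , _) = trans x (sym y)
    ... | _ , inj₁ (_ , f₁) | _ , inj₁ (_ , f₂) with arrowRel-sound j n m f₁ | arrowRel-sound j n' m f₂
    ... | a₁ , ea₁ , x₁ , mx₁ , tx₁ | a₂ , ea₂ , x₂ , mx₂ , tx₂ with toℕ-injective {i = x₁} {j = x₂} (trans tx₁ (sym tx₂))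
    ... | refl with injective (pmap f) a₁ a₂ x₁ mx₁ mx₂
    ... | refl = trans (sym ea₁) ea₂
    below-t0 : ∀ {i'' : Fin k} (a : Fin (size (Src i''))) → i'' ≡ t0 → toℕ a ℕ.< size (Src t0)
    below-t0 a refl = toℕ<n a
    from : ∀ (a : Fin (size (Src i'))) m → R (toℕ a) m ≡ true → node (Src i') a ≡ true
    from a m h with E _ m h
    ... | _ , inj₁ (ei , fr) with arrowRel-sound j _ m fr
    ... | a₁ , ea₁ , x₁ , mx₁ , _ = trans (proj₂ (sameIdx ei a a₁ (sym ea₁))) (on-nodes (pmap f) a₁ x₁ mx₁)
    from a m h | _ , inj₂ (ei , en , nd) with sameIdx ei a (F.fromℕ< (below-t0 a ei)) (sym (toℕ-fromℕ< _))
    ... | _ , ns = trans ns (nodeℕ-sound (Src t0) _ (subst (λ v → nodeℕ (Src t0) v ≡ true) (trans (sym en) (sym (toℕ-fromℕ< _))) nd))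
    to : ∀ n (b : Fin (size (Src t0))) → R n (toℕ b) ≡ true → node (Src t0) b ≡ true
    to n b h with E n _ h
    ... | _ , inj₁ (_ , fr) with arrowRel-sound j n _ fr
    ... | a₁ , _ , x₁ , mx₁ , tx₁ with toℕ-injective {i = x₁} {j = b} tx₁
    ... | refl = lands f a₁ x₁ mx₁
    to n b h | _ , inj₂ (_ , _ , nd) = nodeℕ-sound (Src t0) b nd
    typ : ∀ a b → R (toℕ a) (toℕ b) ≡ true → type (Src t0) b ≡ type (Src i') a
    typ a b h with E _ _ h
    ... | _ , inj₁ (ei , fr) with arrowRel-sound j _ _ fr
    ... | a₁ , ea₁ , x₁ , mx₁ , tx₁ with toℕ-injective {i = x₁} {j = b} tx₁
    ... | refl = trans (typed (pmap f) a₁ x₁ mx₁) (proj₁ (sameIdx ei a a₁ (sym ea₁)))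
    typ a b h | _ , inj₂ (ei , en , _) = proj₁ (sameIdx ei a b en)

  arrowWit-ok : ∀ i' j → IsMorphismRel (Src i') (slotGraph (arrowWit j)) (relFromCopy i' (arrowWit j))
  arrowWit-ok i' j = is-morphism-rel fun inj from to typ
    where open ArrowWitRel i' j

  relFromCopy-ok : ∀ i' d → IsMorphismRel (Src i') (slotGraph d) (relFromCopy i' d)
  relFromCopy-ok i' (nodeWit i z) = atNode-ok i' i z _ (λ _ → refl) (λ _ _ → refl)
  relFromCopy-ok i' (loopWit i z) = atNode-ok i' i z _ (λ _ → refl) (λ _ _ → refl)
  relFromCopy-ok i' (apartWit i z c) = atNode-ok i' i z _ (λ _ → refl) type0
    where
    type0 : ∀ b → toℕ b ≡ 0 → type (slotGraph (apartWit i z c)) b ≡ type (Src i) z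
    type0 b e with fin2-0 b e
    ... | refl = refl
  relFromCopy-ok i' (edgeWit i z w) = edgeWit-ok i' i z w
  relFromCopy-ok i' (arrowWit j) = arrowWit-ok i' j
  relFromCopy-ok i' matchL = guarded-ok zero (idRel (LHS q)) (idRel-ok (LHS q) (LHS q) universe-type (universe-node (VL q))) i'
  relFromCopy-ok i' matchK = guarded-ok (suc zero) (idRel (Nih q)) (idRel-ok (Nih q) (Nih q) universe-type (universe-node (Knode q))) i'
  relFromCopy-ok i' (copy _) = empty-rel

  entryRel-ok : ∀ X Y → IsMorphismRel (entryGraph X) (entryGraph Y) (entryRel X Y)
  entryRel-ok entryK (slot d) = relFromK-ok d
  entryRel-ok (slot (copy i)) (slot d) = relFromCopy-ok i d
  entryRel-ok entryR Y = empty-rel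
  entryRel-ok unused Y = empty-rel
  entryRel-ok entryK entryR = empty-rel
  entryRel-ok entryK entryK = empty-rel
  entryRel-ok entryK unused = empty-rel
  entryRel-ok (slot (copy i)) entryR = empty-rel
  entryRel-ok (slot (copy i)) entryK = empty-rel
  entryRel-ok (slot (copy i)) unused = empty-rel
  entryRel-ok (slot (arrowWit _)) Y = empty-rel
  entryRel-ok (slot matchL) Y = empty-rel
  entryRel-ok (slot matchK) Y = empty-rel
  entryRel-ok (slot (nodeWit _ _)) Y = empty-rel
  entryRel-ok (slot (apartWit _ _ _)) Y = empty-rel
  entryRel-ok (slot (edgeWit _ _ _)) Y = empty-rel
  entryRel-ok (slot (loopWit _ _)) Y = empty-rel

  tgtRel-ok : ∀ s t → IsMorphismRel (Tgt s) (Tgt t) (entryRel (entry s) (entry t))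
  tgtRel-ok zero zero = entryRel-ok entryR entryR
  tgtRel-ok zero (suc zero) = entryRel-ok entryR entryK
  tgtRel-ok zero (suc (suc y)) = entryRel-ok entryR (entry (suc (suc y)))
  tgtRel-ok (suc zero) zero = entryRel-ok entryK entryR
  tgtRel-ok (suc zero) (suc zero) = entryRel-ok entryK entryK
  tgtRel-ok (suc zero) (suc (suc y)) = entryRel-ok entryK (entry (suc (suc y)))
  tgtRel-ok (suc (suc x)) zero = entryRel-ok (entry (suc (suc x))) entryR
  tgtRel-ok (suc (suc x)) (suc zero) = entryRel-ok (entry (suc (suc x))) entryK
  tgtRel-ok (suc (suc x)) (suc (suc y)) = entryRel-ok (entry (suc (suc x))) (entry (suc (suc y)))

  tgtMap-sound : ∀ s t → ¬ s ≡ t → ∀ a b → tgtMap s t a ≡ just b → entryRel (entry s) (entry t) (toℕ a) (toℕ b) ≡ true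
  tgtMap-sound s t ne a b h = subst (_≡ true) (tgtRel-distinct s t _ _ ne) (find-sound _ b h)

  tgtMap-complete : ∀ s t → ¬ s ≡ t → ∀ a b → entryRel (entry s) (entry t) (toℕ a) (toℕ b) ≡ true → tgtMap s t a ≡ just b
  tgtMap-complete s t ne a b h = find-unique _ b (subst (_≡ true) (sym (tgtRel-distinct s t _ _ ne)) h) u
    where
    u : ∀ b' → tgtRel s t (toℕ a) (toℕ b') ≡ true → b' ≡ b
    u b' h' = toℕ-injective (functional (tgtRel-ok s t) (toℕ a) (toℕ b') (toℕ b) (subst (_≡ true) (tgtRel-distinct s t _ _ ne) h') h)

  tgtMor : (s t : Fin k') → ¬ s ≡ t → PMor (Tgt s) (Tgt t)
  tgtMor s t ne = record
    { pmap = record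
      { map = tgtMap s t
      ; injective = λ a a' x h h' → toℕ-injective (rel-injective ok (toℕ a) (toℕ a') (toℕ x) (sound a x h) (sound a' x h'))
      ; typed = λ a x h → rel-typed ok a x (sound a x h)
      ; on-nodes = λ a x h → from-nodes ok a (toℕ x) (sound a x h) }
    ; lands = λ a x h → to-nodes ok (toℕ a) x (sound a x h) }
    where
    ok : IsMorphismRel (Tgt s) (Tgt t) (entryRel (entry s) (entry t))
    ok = tgtRel-ok s t
    sound : ∀ a b → tgtMap s t a ≡ just b → entryRel (entry s) (entry t) (toℕ a) (toℕ b) ≡ true
    sound = tgtMap-sound s t ne

  -- The arrows: one per listed pair of positions; a pair without an arrow
  -- is filled with a harmless duplicate of the arrow K → matchL.
  abstract
    allPairs : L.List (Fin k' × Fin k')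
    allPairs = L.concatMap (λ s → L.map (s ,_) (L.allFin k')) (L.allFin k')

    pair-listed : ∀ s t → (s , t) ∈ allPairs
    pair-listed s t = ∈-concatMap (λ s → L.map (s ,_) (L.allFin k')) (∈-allFin s) (∈-map⁺ (s ,_) (∈-allFin t))

  na' : ℕ
  na' = L.length allPairs

  arrowFor : (s t : Fin k') → hasArrow s t ≡ true → Arrow Tgt
  arrowFor s t v = record { src = s ; tgt = t ; mor = tgtMor s t (hasArrow-distinct s t v) }

  dummy-hasArrow : hasArrow (suc zero) (place matchL) ≡ true
  dummy-hasArrow = subst (λ X → isSource entryK ∧ isSink X ≡ true) (sym (entry-place matchL)) refl

  arrowOrDummy : (s t : Fin k') → (hasArrow s t ≡ true) ⊎ (hasArrow s t ≡ false) → Arrow Tgt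
  arrowOrDummy s t (inj₁ v) = arrowFor s t v
  arrowOrDummy s t (inj₂ _) = arrowFor (suc zero) (place matchL) dummy-hasArrow

  arrowAt : Fin k' × Fin k' → Arrow Tgt
  arrowAt (s , t) = arrowOrDummy s t (bool-cases (hasArrow s t))

  tgtArrow : Fin na' → Arrow Tgt
  tgtArrow y = arrowAt (L.lookup allPairs y)

  arrowAt-hasArrow : ∀ st → hasArrow (src (arrowAt st)) (tgt (arrowAt st)) ≡ true
  arrowAt-hasArrow (s , t) with bool-cases (hasArrow s t)
  ... | inj₁ v = v
  ... | inj₂ _ = dummy-hasArrow

  arrowAt-map : ∀ st a → map (pmap (mor (arrowAt st))) a ≡ tgtMap (src (arrowAt st)) (tgt (arrowAt st)) a
  arrowAt-map (s , t) a with bool-cases (hasArrow s t)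
  ... | inj₁ v = refl
  ... | inj₂ _ = refl

  arrowAt-real : ∀ s t (v : hasArrow s t ≡ true) → arrowAt (s , t) ≡ arrowFor s t v
  arrowAt-real s t v with bool-cases (hasArrow s t)
  ... | inj₁ v' = cong (arrowFor s t) (bool-uip v' v)
  ... | inj₂ f = ⊥-elim (true≢false v f)

  arrowIndex : ∀ s t → Fin na'
  arrowIndex s t = position (pair-listed s t)

  arrowIndex-correct : ∀ s t (v : hasArrow s t ≡ true) → tgtArrow (arrowIndex s t) ≡ arrowFor s t v
  arrowIndex-correct s t v = trans (cong arrowAt (lookup-position (pair-listed s t))) (arrowAt-real s t v)

  -- Commutativity: no arrow leaves a sink, so every path has length ≤ 1 and
  -- composes to tgtMap of its endpoints.
  sink-path-trivial : ∀ {s l} → isSink (entry s) ≡ true → (p : Path Tgt tgtArrow s l) →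
                      Σ (s ≡ l) λ e → ∀ b → compose p b ≡ just (subst (λ x → Fin (size (Tgt x))) e b)
  sink-path-trivial h [] = refl , λ b → refl
  sink-path-trivial h (j ∷ p) = ⊥-elim (not-source-and-sink _ (∧-l _ _ (arrowAt-hasArrow (L.lookup allPairs j))) h)

  bind-id : ∀ {A : Set} (x : Maybe A) (g : A → Maybe A) → (∀ b → g b ≡ just b) → (x >>= g) ≡ x
  bind-id (just a) g h = h a
  bind-id nothing g h = refl

  path-composes-to : ∀ {i l} (p : Path Tgt tgtArrow i l) a → compose p a ≡ tgtMap i l a
  path-composes-to {i} [] a = sym (tgtMap-refl i a)
  path-composes-to (j ∷ p) a
    with sink-path-trivial (∧-r (isSource (entry (src (tgtArrow j)))) _ (arrowAt-hasArrow (L.lookup allPairs j))) p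
  ... | refl , h = trans (cong (_>>= compose p) (arrowAt-map (L.lookup allPairs j) a))
                         (bind-id (tgtMap (src (tgtArrow j)) (tgt (tgtArrow j)) a) (compose p) h)

  tgt-commutes : Commutes Tgt tgtArrow
  tgt-commutes i l p₁ p₂ a = trans (path-composes-to p₁ a) (sym (path-composes-to p₂ a))

  edgeRel-ends : ∀ i' i z w n m → relFromCopy i' (edgeWit i z w) n m ≡ true →
                 (i' ≡ i) × (((n ≡ toℕ z) × (m ≡ 0)) ⊎ ((n ≡ toℕ w) × (m ≡ 1)))
  edgeRel-ends i' i z w n m h with edgeRel-sound i' i z w n m h
  ... | ei , _ , inj₁ e = ei , inj₁ e
  ... | ei , _ , inj₂ (_ , e) = ei , inj₂ e

  arrowWitRel-cases : ∀ i' j n m → relFromCopy i' (arrowWit j) n m ≡ true →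
                      ((i' ≡ src (srcArrow j)) × (arrowRel j n m ≡ true)) ⊎ ((i' ≡ tgt (srcArrow j)) × (n ≡ m))
  arrowWitRel-cases i' j n m h with proj₂ (arrowWitRel-sound i' j n m h)
  ... | inj₁ e = inj₁ e
  ... | inj₂ (ei , en , _) = inj₂ (ei , en)

  guardedId-sound : ∀ i' i₀ (B : Graph T) n m → ⌊ i' F.≟ i₀ ⌋ ∧ idRel B n m ≡ true →
                    (i' ≡ i₀) × (n ≡ m) × (nodeℕ B m ≡ true)
  guardedId-sound i' i₀ B n m h with guard-sound i' i₀ _ h
  ... | ei , r = ei , idRel-sound B n m r

  edge01-true : ∀ a b → edge01 {T} true a b ≡ true → (a ≡ zero) × (b ≡ suc zero)
  edge01-true zero (suc zero) _ = refl , refl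
  edge01-true zero zero ()
  edge01-true (suc zero) zero ()
  edge01-true (suc zero) (suc zero) ()

  -- The translated formula.  A set B of indices records which graphs of C
  -- are bound; translate B φ is read with copy i bound iff B i.

  ⊥F ⊤F : Formula k'
  ⊥F = P zero host ∧F ¬F (P zero host)
  ⊤F = ¬F ⊥F

  bigAnd : ∀ {n} → (Fin n → Formula k') → Formula k'
  bigAnd {zero} f = ⊤F
  bigAnd {suc n} f = f zero ∧F bigAnd (λ c → f (suc c))

  bigOr : ∀ {n} → (Fin n → Formula k') → Formula k'
  bigOr {zero} f = ⊥F
  bigOr {suc n} f = f zero ∨F bigOr (λ c → f (suc c))

  guardA guardO : Bool → Formula k' → Formula k'
  guardA b φ = if b then φ else ⊤F
  guardO b φ = if b then φ else ⊥F

  copyIx : Fin k → Fin k'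
  copyIx i = place (copy i)

  -- node z of copy i is mapped / mapped to a node of H'
  DefinedF PresentF : (i : Fin k) → Fin (size (Src i)) → Formula k'
  DefinedF i z = ∃F (place (nodeWit i z)) (P (place (nodeWit i z)) co)
  PresentF i z = ∃F (place (nodeWit i z)) (P (place (nodeWit i z)) host)

  -- node z of copy i is mapped to some x ≠ m c / to m c
  ApartF AtMatchF : (i : Fin k) → Fin (size (Src i)) → Fin NN → Formula k'
  ApartF i z c = ∃F (place (apartWit i z c)) (P (place (apartWit i z c)) co)
  AtMatchF i z c = DefinedF i z ∧F ¬F (ApartF i z c)

  EdgePresentF : (i : Fin k) → Fin (size (Src i)) → Fin (size (Src i)) → Formula k'
  EdgePresentF i z w = if ⌊ z F.≟ w ⌋ then ∃F (place (loopWit i z)) (P (place (loopWit i z)) host)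
                                       else ∃F (place (edgeWit i z w)) (P (place (edgeWit i z w)) host)

  -- the image of z is a node of H, resp. the images of z, w are joined by an
  -- edge of H: the undo rule, with images of the match expressed by AtMatchF
  NodeBeforeF : (i : Fin k) → Fin (size (Src i)) → Formula k'
  NodeBeforeF i z = (PresentF i z ∧F ¬F (bigOr λ c → guardO (addNode q c) (AtMatchF i z c))) ∨F
                    bigOr (λ c → guardO (delNode q c) (AtMatchF i z c))

  EdgeBeforeF : (i : Fin k) → Fin (size (Src i)) → Fin (size (Src i)) → Formula k'
  EdgeBeforeF i z w =
    (EdgePresentF i z w ∧F ¬F (bigOr λ a → bigOr λ b → guardO (addEdge q a b) (AtMatchF i z a ∧F AtMatchF i w b))) ∨F
    (bigOr λ a → bigOr λ b → guardO (delEdge q a b) (AtMatchF i z a ∧F AtMatchF i w b))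

  holdsF : Target → Formula k' → Formula k'
  holdsF host φ = φ
  holdsF co φ = ¬F φ

  TotalF : Fin k → Target → Formula k'
  TotalF i host = bigAnd (λ z → guardA (node (Src i) z) (DefinedF i z ∧F NodeBeforeF i z)) ∧F
                  bigAnd (λ z → bigAnd λ w → guardA (edge (Src i) z w) ((DefinedF i z ∧F DefinedF i w) ⇒F EdgeBeforeF i z w))
  TotalF i co = bigAnd (λ z → guardA (node (Src i) z) (DefinedF i z)) ∧F
                bigAnd (λ z → bigAnd λ w → guardA (edge (Src i) z w) ((DefinedF i z ∧F DefinedF i w) ⇒F ¬F (EdgeBeforeF i z w)))

  SomeEdgeF : Fin k → Target → Formula k'
  SomeEdgeF i t = bigOr λ z → bigOr λ w →
                    guardO (edge (Src i) z w) (DefinedF i z ∧F (DefinedF i w ∧F holdsF t (EdgeBeforeF i z w)))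

  bind : (Fin k → Bool) → Fin k → Fin k → Bool
  bind B i j = if ⌊ i F.≟ j ⌋ then true else B j

  CompatibleF : (Fin k → Bool) → Formula k'
  CompatibleF B = bigAnd λ j → guardA (B (src (srcArrow j)) ∧ (B (tgt (srcArrow j)) ∧ not ⌊ src (srcArrow j) F.≟ tgt (srcArrow j) ⌋))
                                      (∃F (place (arrowWit j)) ⊤F)

  translate : (Fin k → Bool) → Formula k → Formula k'
  translate B (P i t) = if B i then TotalF i t else ⊥F
  translate B (Q i t) = if B i then SomeEdgeF i t else ⊥F
  translate B (¬F φ) = ¬F (translate B φ)
  translate B (φ ∧F ψ) = translate B φ ∧F translate B ψ
  translate B (φ ∨F ψ) = translate B φ ∨F translate B ψ
  translate B (φ ⇒F ψ) = translate B φ ⇒F translate B ψ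
  translate B (∀F i φ) = ∀F (copyIx i) (CompatibleF (bind B i) ⇒F translate (bind B i) φ)
  translate B (∃F i φ) = ∃F (copyIx i) (CompatibleF (bind B i) ∧F translate (bind B i) φ)

  initiallyBound : Fin k → Bool
  initiallyBound zero = true
  initiallyBound (suc zero) = true
  initiallyBound (suc (suc _)) = false

  -- Bind copies 0 and 1 to maps agreeing with the match (forced by matchL,
  -- matchK), then evaluate the translated formula of C.
  translatedFormula : Formula k'
  translatedFormula = ∃F (copyIx zero) (∃F (place matchL) ⊤F ∧F
                        ∃F (copyIx (suc zero)) (∃F (place matchK) ⊤F ∧F translate initiallyBound (formula C)))

  translated : Condition L⁻¹ K⁻¹
  translated = record { extra = e' ; others = newOthers ; arrows = na' ; arrow = tgtArrow
                      ; commutes = tgt-commutes ; formula = translatedFormula }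

  entryRel-into-slot : ∀ X d n m → entryRel X (slot d) n m ≡ true →
                       ((X ≡ entryK) × (relFromK d n m ≡ true)) ⊎
                       (Σ (Fin k) λ i' → (X ≡ slot (copy i')) × (relFromCopy i' d n m ≡ true))
  entryRel-into-slot entryK d n m h = inj₁ (refl , h)
  entryRel-into-slot (slot (copy i')) d n m h = inj₂ (i' , refl , h)
  entryRel-into-slot entryR d n m ()
  entryRel-into-slot unused d n m ()
  entryRel-into-slot (slot (arrowWit _)) d n m ()
  entryRel-into-slot (slot matchL) d n m ()
  entryRel-into-slot (slot matchK) d n m ()
  entryRel-into-slot (slot (nodeWit _ _)) d n m ()
  entryRel-into-slot (slot (apartWit _ _ _)) d n m ()
  entryRel-into-slot (slot (edgeWit _ _ _)) d n m ()
  entryRel-into-slot (slot (loopWit _ _)) d n m ()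

  isSnk : Slot → Bool
  isSnk d = isSink (slot d)

  K-hasArrow : ∀ d → isSnk d ≡ true → hasArrow (suc zero) (place d) ≡ true
  K-hasArrow d h = subst (λ X → isSource entryK ∧ isSink X ≡ true) (sym (entry-place d)) h

  copy-hasArrow : ∀ i d → isSnk d ≡ true → hasArrow (place (copy i)) (place d) ≡ true
  copy-hasArrow i d h = subst₂ (λ X Y → isSource X ∧ isSink Y ≡ true) (sym (entry-place (copy i))) (sym (entry-place d)) h

  module Correctness (H : Graph T) (m : Fin NN → Fin (size H)) (m-inj : ∀ a b → m a ≡ m b → a ≡ b)
              (m-typed : ∀ a → type H (m a) ≡ ty q a)
              (nH : Fin (size H) → Bool) (eH : Fin (size H) → Fin (size H) → Bool)
              (srcH : ∀ a b → eH a b ≡ true → nH a ≡ true) (tgtH : ∀ a b → eH a b ≡ true → nH b ≡ true)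
              (hn : UndoesNodes q m (node H) nH) (he : UndoesEdges q m (edge H) eH) where

    H' : Graph T
    H' = record { size = size H ; node = nH ; edge = eH ; type = type H ; edge-src = srcH ; edge-tgt = tgtH }

    module Sr = Semantics Src srcArrow H
    module Tg = Semantics Tgt tgtArrow H'

    -- Transport of partial maps along an equality of graphs (the witness
    -- graphs are Tgt (place d) only up to a propositional equality).
    castPM : ∀ {A B : Graph T} → A ≡ B → PMap A H' → PMap B H'
    castPM refl ν = ν

    castPM-map : ∀ {A B : Graph T} (e : A ≡ B) (ν : PMap A H') (a : Fin (size A)) (b : Fin (size B)) →
                 toℕ a ≡ toℕ b → map (castPM e ν) b ≡ map ν a
    castPM-map refl ν a b h with toℕ-injective {i = a} {j = b} h
    ... | refl = refl

    castF : ∀ {A B : Graph T} → A ≡ B → Fin (size A) → Fin (size B)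
    castF refl a = a

    castF-toℕ : ∀ {A B : Graph T} (e : A ≡ B) a → toℕ (castF e a) ≡ toℕ a
    castF-toℕ refl a = refl

    total-cast : ∀ {A B : Graph T} (e : A ≡ B) (ν : PMap A H') t → Tg.Total ν t → Tg.Total (castPM e ν) t
    total-cast refl ν t h = h

    open UpdateLemmas Tgt tgtArrow H' renaming (update-same to upd-same; update-other to upd-other)
    open UpdateLemmas Src srcArrow H renaming (update-same to Supd-same; update-other to Supd-other)

    PairCompat : Tg.Env → Fin k' → Fin k' → Set
    PairCompat ρ s t = ∀ μ ν → ρ s ≡ just μ → ρ t ≡ just ν → ∀ a b → tgtMap s t a ≡ just b → map μ a ≡ map ν b

    ArrowCompat : Tg.Env → Arrow Tgt → Set
    ArrowCompat ρ α = ∀ μ ν → ρ (src α) ≡ just μ → ρ (tgt α) ≡ just ν → ∀ a b → map (pmap (mor α)) a ≡ just b → map μ a ≡ map ν b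

    compatible→pairs : ∀ ρ → Tg.Compatible ρ → ∀ s t → hasArrow s t ≡ true → PairCompat ρ s t
    compatible→pairs ρ c s t v = subst (ArrowCompat ρ) (arrowIndex-correct s t v) (c (arrowIndex s t))

    pairs→compatible : ∀ ρ → (∀ s t → hasArrow s t ≡ true → PairCompat ρ s t) → Tg.Compatible ρ
    pairs→compatible ρ h j = go (L.lookup allPairs j)
      where
      go : ∀ st → ArrowCompat ρ (arrowAt st)
      go (s , t) with bool-cases (hasArrow s t)
      ... | inj₁ v = h s t v
      ... | inj₂ _ = h (suc zero) (place matchL) dummy-hasArrow

    SinksUnbound : Tg.Env → Set
    SinksUnbound ρ = ∀ x → isSink (entry x) ≡ true → ρ x ≡ nothing

    sinks-unbound-compatible : ∀ ρ → SinksUnbound ρ → Tg.Compatible ρ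
    sinks-unbound-compatible ρ sf = pairs→compatible ρ λ s t v μ ν es et → ⊥-elim (nothing≢just (trans (sym (sf t (∧-r (isSource (entry s)) _ v))) et))

    SinkCompat : Tg.Env → (S : Fin k') → PMap (Tgt S) H' → Set
    SinkCompat ρ S μS = ∀ s → hasArrow s S ≡ true → ∀ ν → ρ s ≡ just ν → ∀ a b → tgtMap s S a ≡ just b → map ν a ≡ map μS b

    update-compatible→ : ∀ ρ S μS → Tg.Compatible (Tg.update ρ S μS) → SinkCompat ρ S μS
    update-compatible→ ρ S μS c s v ν es a b h =
      compatible→pairs (Tg.update ρ S μS) c s S v ν μS (trans (upd-other ρ S μS s (λ e → hasArrow-distinct s S v (sym e))) es) (upd-same ρ S μS) a b h

    update-compatible← : ∀ ρ S μS → SinksUnbound ρ → SinkCompat ρ S μS → Tg.Compatible (Tg.update ρ S μS)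
    update-compatible← ρ S μS sf sc = pairs→compatible _ go
      where
      go : ∀ s t → hasArrow s t ≡ true → PairCompat (Tg.update ρ S μS) s t
      go s t v μ ν es et a b h with S F.≟ t
      ... | no ne = ⊥-elim (nothing≢just (trans (sym (sf t (∧-r (isSource (entry s)) _ v))) et))
      ... | yes refl with et
      ... | refl = sc s v μ (trans (sym (upd-other ρ S μS s (λ e → hasArrow-distinct s S v (sym e)))) es) a b h

    CompatibleWit : Tg.Env → (d : Slot) → PMap (slotGraph d) H' → Set
    CompatibleWit ρ d ν1 = ∀ s → hasArrow s (place d) ≡ true → ∀ ν → ρ s ≡ just ν → ∀ a (b1 : Fin (size (slotGraph d))) →
                     entryRel (entry s) (slot d) (toℕ a) (toℕ b1) ≡ true → map ν a ≡ map ν1 b1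

    wit-compatible→ : ∀ ρ d → (μS : PMap (Tgt (place d)) H') → Tg.Compatible (Tg.update ρ (place d) μS) →
                CompatibleWit ρ d (castPM (Tgt-place d) μS)
    wit-compatible→ ρ d μS c s v ν es a b1 h =
      trans (update-compatible→ ρ (place d) μS c s v ν es a b
                (tgtMap-complete s (place d) (hasArrow-distinct s (place d) v) a b
                   (subst (λ X → entryRel (entry s) X (toℕ a) (toℕ b) ≡ true) (sym (entry-place d))
                      (subst (λ n → entryRel (entry s) (slot d) (toℕ a) n ≡ true) (sym tb) h))))
            (sym (castPM-map (Tgt-place d) μS b b1 tb))
      where
      b : Fin (size (Tgt (place d)))
      b = castF (sym (Tgt-place d)) b1
      tb : toℕ b ≡ toℕ b1
      tb = castF-toℕ (sym (Tgt-place d)) b1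

    wit-compatible← : ∀ ρ d → SinksUnbound ρ → (ν1 : PMap (slotGraph d) H') → CompatibleWit ρ d ν1 →
                Tg.Compatible (Tg.update ρ (place d) (castPM (sym (Tgt-place d)) ν1))
    wit-compatible← ρ d sf ν1 cd = update-compatible← ρ (place d) _ sf sc
      where
      sc : SinkCompat ρ (place d) (castPM (sym (Tgt-place d)) ν1)
      sc s v ν es a b h =
        trans (cd s v ν es a b1
                 (subst (λ n → entryRel (entry s) (slot d) (toℕ a) n ≡ true) tb
                   (subst (λ X → entryRel (entry s) X (toℕ a) (toℕ b) ≡ true) (entry-place d)
                     (tgtMap-sound s (place d) (hasArrow-distinct s (place d) v) a b h))))
              (sym (castPM-map (sym (Tgt-place d)) ν1 b1 b (sym tb)))
        where
        b1 : Fin (size (slotGraph d))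
        b1 = castF (Tgt-place d) b
        tb : toℕ b ≡ toℕ b1
        tb = sym (castF-toℕ (Tgt-place d) b)

    ⊥F-e : ∀ ρ → Tg.⟦ ⊥F ⟧ ρ → ⊥
    ⊥F-e ρ (x , nx) = nx x

    ⊤F-i : ∀ ρ → Tg.⟦ ⊤F ⟧ ρ
    ⊤F-i ρ (x , nx) = nx x

    Kmatch : PMap K⁻¹ H'
    Kmatch = matchMap K⁻¹ H' m m-inj m-typed

    toH' : ∀ {A : Graph T} → PMap A H → PMap A H'
    toH' μ = record { map = map μ ; injective = injective μ ; typed = typed μ ; on-nodes = on-nodes μ }

    castNode : ∀ {A B : Graph T} (e : A ≡ B) (a : Fin (size A)) (b : Fin (size B)) → toℕ a ≡ toℕ b → node A a ≡ node B b
    castNode refl a b h with toℕ-injective {i = a} {j = b} h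
    ... | refl = refl

    castFin : ∀ {A B : Graph T} → A ≡ B → (a : Fin (size A)) → Σ (Fin (size B)) λ b → toℕ b ≡ toℕ a
    castFin refl a = a , refl

    Agree : ∀ {i : Fin k} → PMap (Src i) H → PMap (Tgt (place (copy i))) H' → Set
    Agree μ μ' = ∀ a a' → toℕ a ≡ toℕ a' → map μ a ≡ map μ' a'

    bigAnd-sem : ∀ {n} (f : Fin n → Formula k') ρ → Tg.⟦ bigAnd f ⟧ ρ ↔ (∀ c → Tg.⟦ f c ⟧ ρ)
    bigAnd-sem {zero} f ρ = (λ _ ()) , (λ _ → ⊤F-i ρ)
    proj₁ (bigAnd-sem {suc n} f ρ) (h0 , hr) zero = h0
    proj₁ (bigAnd-sem {suc n} f ρ) (h0 , hr) (suc c) = proj₁ (bigAnd-sem (λ c → f (suc c)) ρ) hr c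
    proj₂ (bigAnd-sem {suc n} f ρ) h = h zero , proj₂ (bigAnd-sem (λ c → f (suc c)) ρ) (λ c → h (suc c))

    bigOr-sem : ∀ {n} (f : Fin n → Formula k') ρ → Tg.⟦ bigOr f ⟧ ρ ↔ Σ (Fin n) (λ c → Tg.⟦ f c ⟧ ρ)
    bigOr-sem {zero} f ρ = (λ x → ⊥-elim (⊥F-e ρ x)) , (λ { (() , _) })
    proj₁ (bigOr-sem {suc n} f ρ) (inj₁ h) = zero , h
    proj₁ (bigOr-sem {suc n} f ρ) (inj₂ h) with proj₁ (bigOr-sem (λ c → f (suc c)) ρ) h
    ... | c , h' = suc c , h'
    proj₂ (bigOr-sem {suc n} f ρ) (zero , h) = inj₁ h
    proj₂ (bigOr-sem {suc n} f ρ) (suc c , h) = inj₂ (proj₂ (bigOr-sem (λ c → f (suc c)) ρ) (c , h))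

    guardA-sem : ∀ b φ ρ → Tg.⟦ guardA b φ ⟧ ρ ↔ (b ≡ true → Tg.⟦ φ ⟧ ρ)
    guardA-sem true φ ρ = (λ h _ → h) , (λ h → h refl)
    guardA-sem false φ ρ = (λ _ ()) , (λ _ → ⊤F-i ρ)

    guardO-sem : ∀ b φ ρ → Tg.⟦ guardO b φ ⟧ ρ ↔ ((b ≡ true) × Tg.⟦ φ ⟧ ρ)
    guardO-sem true φ ρ = (λ h → refl , h) , proj₂
    guardO-sem false φ ρ = (λ h → ⊥-elim (⊥F-e ρ h)) , (λ { (() , _) })

    open Img m

    module WitnessSemantics (ρ' : Tg.Env) (sf : SinksUnbound ρ') (kt : ρ' (suc zero) ≡ just Kmatch) where

      wit-P-sem : ∀ d t → Tg.⟦ ∃F (place d) (P (place d) t) ⟧ ρ' ↔ Σ (PMap (slotGraph d) H') λ ν1 → CompatibleWit ρ' d ν1 × Tg.Total ν1 t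
      proj₁ (wit-P-sem d t) (μS , c , (μ₀ , e , tot)) with trans (sym (upd-same ρ' (place d) μS)) e
      ... | refl = castPM (Tgt-place d) μS , wit-compatible→ ρ' d μS c , total-cast (Tgt-place d) μS t tot
      proj₂ (wit-P-sem d t) (ν1 , cd , tot) =
        castPM (sym (Tgt-place d)) ν1 , wit-compatible← ρ' d sf ν1 cd ,
        (castPM (sym (Tgt-place d)) ν1 , upd-same ρ' (place d) _ , total-cast (sym (Tgt-place d)) ν1 t tot)

      wit-sem : ∀ d → Tg.⟦ ∃F (place d) ⊤F ⟧ ρ' ↔ Σ (PMap (slotGraph d) H') λ ν1 → CompatibleWit ρ' d ν1
      proj₁ (wit-sem d) (μS , c , _) = castPM (Tgt-place d) μS , wit-compatible→ ρ' d μS c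
      proj₂ (wit-sem d) (ν1 , cd) = castPM (sym (Tgt-place d)) ν1 , wit-compatible← ρ' d sf ν1 cd , ⊤F-i (Tg.update ρ' (place d) (castPM (sym (Tgt-place d)) ν1))

      copyView : ∀ s (i' : Fin k) (ν : PMap (Tgt s) H') → entry s ≡ slot (copy i') → ρ' s ≡ just ν →
                 Σ (PMap (Tgt (place (copy i'))) H') λ ν' → (ρ' (place (copy i')) ≡ just ν') ×
                   (∀ a (a' : Fin (size (Tgt (place (copy i'))))) → toℕ a ≡ toℕ a' → map ν a ≡ map ν' a')
      copyView s i' ν eD es with place-entry s (copy i') eD
      ... | refl = ν , es , λ a a' h → cong (map ν) (toℕ-injective h)

      ktView : ∀ s (ν : PMap (Tgt s) H') → entry s ≡ entryK → ρ' s ≡ just ν → ∀ a (c : Fin NN) → toℕ a ≡ toℕ c → map ν a ≡ just (m c)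
      ktView s ν eD es a c h with entry-K s eD
      ... | refl with trans (sym es) kt
      ... | refl with toℕ-injective {i = a} {j = c} h
      ... | refl = matchMap-defined K⁻¹ H' m m-inj m-typed c (covR c)

      module AtCopy (i : Fin k) (μ : PMap (Src i) H) (μ' : PMap (Tgt (place (copy i))) H')
                  (ec : ρ' (place (copy i)) ≡ just μ') (rp : Agree μ μ') where

        viaCopy : ∀ s (i' : Fin k) (ν : PMap (Tgt s) H') → entry s ≡ slot (copy i') → ρ' s ≡ just ν → i' ≡ i →
                  ∀ a (z : Fin (size (Src i))) → toℕ a ≡ toℕ z → map ν a ≡ map μ z
        viaCopy s i' ν eD es refl a z h with copyView s i' ν eD es
        ... | ν' , ec' , hv with trans (sym ec) ec'
        ... | refl with castFin (sym (Tgt-place (copy i))) z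
        ... | z' , tz = trans (hv a z' (trans h (sym tz))) (sym (rp z z' (sym tz)))

        z'of : (z : Fin (size (Src i))) → Σ (Fin (size (Tgt (place (copy i))))) λ z' → toℕ z' ≡ toℕ z
        z'of z = castFin (sym (Tgt-place (copy i))) z

        relCi : ∀ (a : Fin (size (Tgt (place (copy i))))) d m → relFromCopy i d (toℕ a) m ≡ true → entryRel (entry (place (copy i))) (slot d) (toℕ a) m ≡ true
        relCi a d m h = subst (λ X → entryRel X (slot d) (toℕ a) m ≡ true) (sym (entry-place (copy i))) h

        fromCopy : ∀ d (ν1 : PMap (slotGraph d) H') → isSnk d ≡ true → CompatibleWit ρ' d ν1 →
                   ∀ (z : Fin (size (Src i))) b1 → relFromCopy i d (toℕ z) (toℕ b1) ≡ true → map μ z ≡ map ν1 b1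
        fromCopy d ν1 sn cd z b1 h with z'of z
        ... | z' , tz = trans (rp z z' (sym tz))
                          (cd (place (copy i)) (copy-hasArrow i d sn) μ' ec z' b1 (relCi z' d (toℕ b1) (subst (λ n → relFromCopy i d n (toℕ b1) ≡ true) (sym tz) h)))

        atNode-self : ∀ z → node (Src i) z ≡ true → atNode i i (toℕ z) (toℕ z) 0 ≡ true
        atNode-self z nz rewrite ≟-refl i | eqN-complete (toℕ z) (toℕ z) refl = ∧-intro (nodeℕ-complete (Src i) z nz) refl

        nodeWit-sem : ∀ z t → node (Src i) z ≡ true →
              Tg.⟦ ∃F (place (nodeWit i z)) (P (place (nodeWit i z)) t) ⟧ ρ' ↔ Σ (Fin (size H)) λ x → (map μ z ≡ just x) × NodeOK t H' x
        proj₁ (nodeWit-sem z t nz) h with proj₁ (wit-P-sem (nodeWit i z) t) h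
        ... | ν1 , cd , tot with proj₁ tot zero refl
        ... | x , ex , ok = x , trans (fromCopy (nodeWit i z) ν1 refl cd z zero (atNode-self z nz)) ex , ok
        proj₂ (nodeWit-sem z t nz) (x , ex , ok) = proj₂ (wit-P-sem (nodeWit i z) t) (ν1 , cd , tot)
          where
          ν1 : PMap (slotGraph (nodeWit i z)) H'
          ν1 = pointMap H' false x (typed μ z x ex)
          cd : CompatibleWit ρ' (nodeWit i z) ν1
          cd s v ν es a b1 h with entryRel-into-slot (entry s) (nodeWit i z) _ _ h
          ... | inj₁ (_ , ())
          ... | inj₂ (i' , eD , r) with atNode-sound i' i (toℕ z) _ _ r
          ... | ei , _ , ea , _ = trans (viaCopy s i' ν eD es ei a z ea) ex
          tot : Tg.Total ν1 t
          tot = (λ a _ → x , refl , ok) , (λ a b x' y' ())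

        -- z is mapped to some x ≠ m c (two distinct nodes of a map).
        apartWit-sem : ∀ z c → node (Src i) z ≡ true →
              Tg.⟦ ∃F (place (apartWit i z c)) (P (place (apartWit i z c)) co) ⟧ ρ' ↔ Σ (Fin (size H)) λ x → (map μ z ≡ just x) × ¬ (x ≡ m c)
        proj₁ (apartWit-sem z c nz) h with proj₁ (wit-P-sem (apartWit i z c) co) h
        ... | ν1 , cd , tot with proj₁ tot zero refl | proj₁ tot (suc zero) refl
        ... | x0 , ex0 , _ | y0 , ey0 , _ =
          x0 , trans (fromCopy (apartWit i z c) ν1 refl cd z zero (atNode-self z nz)) ex0 , neq
          where
          rk : relFromK (apartWit i z c) (toℕ c) 1 ≡ true
          rk rewrite eqN-complete (toℕ c) (toℕ c) refl = refl
          kc : map Kmatch c ≡ map ν1 (suc zero)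
          kc = cd (suc zero) (K-hasArrow (apartWit i z c) refl) Kmatch kt c (suc zero) rk
          neq : ¬ (x0 ≡ m c)
          neq e with injective ν1 zero (suc zero) x0 ex0
                       (trans ey0 (cong just (trans (just-inj (trans (sym ey0) (trans (sym kc) (matchMap-defined K⁻¹ H' m m-inj m-typed c (covR c))))) (sym e))))
          ... | ()
        proj₂ (apartWit-sem z c nz) (x , ex , ne) = proj₂ (wit-P-sem (apartWit i z c) co) (ν1 , cd , tot)
          where
          ν1 : PMap (slotGraph (apartWit i z c)) H'
          ν1 = pairMap H' false x (m c) ne (typed μ z x ex) (m-typed c)
          cd : CompatibleWit ρ' (apartWit i z c) ν1
          cd s v ν es a b1 h with entryRel-into-slot (entry s) (apartWit i z c) _ _ h
          ... | inj₁ (eK , r) with fin2-1 b1 (eqN-sound _ _ (∧-r (eqN (toℕ a) (toℕ c)) _ r))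
          ... | refl = ktView s ν eK es a c (eqN-sound _ _ (∧-l _ _ r))
          cd s v ν es a b1 h | inj₂ (i' , eD , r) with atNode-sound i' i (toℕ z) _ _ r
          ... | ei , _ , ea , eb with fin2-0 b1 eb
          ... | refl = trans (viaCopy s i' ν eD es ei a z ea) ex
          e2f : ∀ a b → edge01 {T} false a b ≡ true → ⊥
          e2f zero zero ()
          e2f zero (suc zero) ()
          e2f (suc zero) zero ()
          e2f (suc zero) (suc zero) ()
          tot : Tg.Total ν1 co
          tot = (λ { zero _ → x , refl , tt ; (suc zero) _ → m c , refl , tt }) , (λ a b _ _ e _ _ → ⊥-elim (e2f a b e))

        loopWit-sem : ∀ z → node (Src i) z ≡ true →
              Tg.⟦ ∃F (place (loopWit i z)) (P (place (loopWit i z)) host) ⟧ ρ' ↔ Σ (Fin (size H)) λ x → (map μ z ≡ just x) × (edge H' x x ≡ true)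
        proj₁ (loopWit-sem z nz) h with proj₁ (wit-P-sem (loopWit i z) host) h
        ... | ν1 , cd , tot with proj₁ tot zero refl
        ... | x0 , ex0 , _ = x0 , trans (fromCopy (loopWit i z) ν1 refl cd z zero (atNode-self z nz)) ex0 , proj₂ tot zero zero x0 x0 refl ex0 ex0
        proj₂ (loopWit-sem z nz) (x , ex , exx) = proj₂ (wit-P-sem (loopWit i z) host) (ν1 , cd , tot)
          where
          ν1 : PMap (slotGraph (loopWit i z)) H'
          ν1 = pointMap H' true x (typed μ z x ex)
          cd : CompatibleWit ρ' (loopWit i z) ν1
          cd s v ν es a b1 h with entryRel-into-slot (entry s) (loopWit i z) _ _ h
          ... | inj₁ (_ , ())
          ... | inj₂ (i' , eD , r) with atNode-sound i' i (toℕ z) _ _ r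
          ... | ei , _ , ea , _ = trans (viaCopy s i' ν eD es ei a z ea) ex
          tot : Tg.Total ν1 host
          tot = (λ a _ → x , refl , srcH x x exx) , (λ { a b x' y' _ refl refl → exx })

        edgeWit-sem : ∀ z w → ¬ (z ≡ w) → node (Src i) z ≡ true → node (Src i) w ≡ true →
              Tg.⟦ ∃F (place (edgeWit i z w)) (P (place (edgeWit i z w)) host) ⟧ ρ' ↔
              Σ (Fin (size H)) λ x → Σ (Fin (size H)) λ y → (map μ z ≡ just x) × (map μ w ≡ just y) × (edge H' x y ≡ true)
        proj₁ (edgeWit-sem z w nzw nz nw) h with proj₁ (wit-P-sem (edgeWit i z w) host) h
        ... | ν1 , cd , tot with proj₁ tot zero refl | proj₁ tot (suc zero) refl
        ... | x0 , ex0 , _ | y0 , ey0 , _ =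
          x0 , y0 , trans (fromCopy (edgeWit i z w) ν1 refl cd z zero rz) ex0 ,
          trans (fromCopy (edgeWit i z w) ν1 refl cd w (suc zero) rw) ey0 , proj₂ tot zero (suc zero) x0 y0 refl ex0 ey0
          where
          rz : relFromCopy i (edgeWit i z w) (toℕ z) 0 ≡ true
          rz rewrite ≟-refl i | eqN-complete (toℕ z) (toℕ z) refl = ∧-intro (nodeℕ-complete (Src i) z nz) refl
          nwz : ¬ (toℕ w ≡ toℕ z)
          nwz e = nzw (sym (toℕ-injective e))
          rw : relFromCopy i (edgeWit i z w) (toℕ w) 1 ≡ true
          rw rewrite ≟-refl i | eqN-refute (toℕ w) (toℕ z) nwz | eqN-complete (toℕ w) (toℕ w) refl = ∧-intro (nodeℕ-complete (Src i) w nw) refl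
        proj₂ (edgeWit-sem z w nzw nz nw) (x , y , ex , ey , exy) = proj₂ (wit-P-sem (edgeWit i z w) host) (ν1 , cd , tot)
          where
          nxy : ¬ (x ≡ y)
          nxy e = nzw (injective μ z w x ex (trans ey (cong just (sym e))))
          ν1 : PMap (slotGraph (edgeWit i z w)) H'
          ν1 = pairMap H' true x y nxy (typed μ z x ex) (typed μ w y ey)
          cd : CompatibleWit ρ' (edgeWit i z w) ν1
          cd s v ν es a b1 h with entryRel-into-slot (entry s) (edgeWit i z w) _ _ h
          ... | inj₁ (_ , ())
          ... | inj₂ (i' , eD , r) with edgeRel-ends i' i z w _ _ r
          ... | ei , inj₁ (ea , eb) with fin2-0 b1 eb
          ... | refl = trans (viaCopy s i' ν eD es ei a z ea) ex
          cd s v ν es a b1 h | inj₂ (i' , eD , r) | ei , inj₂ (ea , eb) with fin2-1 b1 eb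
          ... | refl = trans (viaCopy s i' ν eD es ei a w ea) ey
          tot : Tg.Total ν1 host
          tot = (λ { zero _ → x , refl , srcH x y exy ; (suc zero) _ → y , refl , tgtH x y exy }) , te
            where
            te : ∀ a b x' y' → edge01 {T} true a b ≡ true → pairMap-map H' x y a ≡ just x' → pairMap-map H' x y b ≡ just y' →
                 edge H' x' y' ≡ true
            te a b x' y' e ea eb with edge01-true a b e
            te .zero .(suc zero) x' y' e refl refl | refl , refl = exy

        atMatch-sem : ∀ z c → node (Src i) z ≡ true → Tg.⟦ AtMatchF i z c ⟧ ρ' ↔ (map μ z ≡ just (m c))
        proj₁ (atMatch-sem z c nz) (d , nn) with proj₁ (nodeWit-sem z co nz) d
        ... | x , ex , _ with x F.≟ m c
        ... | yes e = trans ex (cong just e)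
        ... | no ne = ⊥-elim (nn (proj₂ (apartWit-sem z c nz) (x , ex , ne)))
        proj₂ (atMatch-sem z c nz) e = proj₂ (nodeWit-sem z co nz) (m c , e , tt) ,
          λ h → let (x' , ex' , ne') = proj₁ (apartWit-sem z c nz) h in ne' (just-inj (trans (sym ex') e))

        img-sem : ∀ (Pr : Fin NN → Bool) z x → node (Src i) z ≡ true → map μ z ≡ just x →
               Tg.⟦ bigOr (λ c → guardO (Pr c) (AtMatchF i z c)) ⟧ ρ' ↔ Img Pr x
        proj₁ (img-sem Pr z x nz ex) h with proj₁ (bigOr-sem _ ρ') h
        ... | c , g with proj₁ (guardO-sem (Pr c) _ ρ') g
        ... | pc , eq = c , just-inj (trans (sym (proj₁ (atMatch-sem z c nz) eq)) ex) , pc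
        proj₂ (img-sem Pr z x nz ex) (c , e , pc) =
          proj₂ (bigOr-sem _ ρ') (c , proj₂ (guardO-sem (Pr c) _ ρ') (pc , proj₂ (atMatch-sem z c nz) (trans ex (cong just (sym e)))))

        img2-sem : ∀ (Pr : Fin NN → Fin NN → Bool) z w x y → node (Src i) z ≡ true → node (Src i) w ≡ true →
                map μ z ≡ just x → map μ w ≡ just y →
                Tg.⟦ bigOr (λ a → bigOr λ b → guardO (Pr a b) (AtMatchF i z a ∧F AtMatchF i w b)) ⟧ ρ' ↔ Img2 Pr x y
        proj₁ (img2-sem Pr z w x y nz nw ex ey) h with proj₁ (bigOr-sem _ ρ') h
        ... | a , h2 with proj₁ (bigOr-sem _ ρ') h2
        ... | b , g with proj₁ (guardO-sem (Pr a b) _ ρ') g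
        ... | pab , (eqa , eqb) = a , b , just-inj (trans (sym (proj₁ (atMatch-sem z a nz) eqa)) ex) ,
                                         just-inj (trans (sym (proj₁ (atMatch-sem w b nw) eqb)) ey) , pab
        proj₂ (img2-sem Pr z w x y nz nw ex ey) (a , b , ea , eb , pab) =
          proj₂ (bigOr-sem _ ρ') (a , proj₂ (bigOr-sem _ ρ') (b , proj₂ (guardO-sem (Pr a b) _ ρ')
            (pab , proj₂ (atMatch-sem z a nz) (trans ex (cong just (sym ea))) , proj₂ (atMatch-sem w b nw) (trans ey (cong just (sym eb))))))

        nodeBefore-sem : ∀ z x → node (Src i) z ≡ true → map μ z ≡ just x → Tg.⟦ NodeBeforeF i z ⟧ ρ' ↔ (node H x ≡ true)
        proj₁ (nodeBefore-sem z x nz ex) (inj₁ (pr , na)) with proj₁ (nodeWit-sem z host nz) pr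
        ... | x' , ex' , nx' with just-inj (trans (sym ex') ex)
        ... | refl = proj₂ (hn x) (inj₁ (nx' , λ im → na (proj₂ (img-sem (addNode q) z x nz ex) im)))
        proj₁ (nodeBefore-sem z x nz ex) (inj₂ d) = proj₂ (hn x) (inj₂ (proj₁ (img-sem (delNode q) z x nz ex) d))
        proj₂ (nodeBefore-sem z x nz ex) h with proj₁ (hn x) h
        ... | inj₁ (nh , ni) = inj₁ (proj₂ (nodeWit-sem z host nz) (x , ex , nh) , λ b → ni (proj₁ (img-sem (addNode q) z x nz ex) b))
        ... | inj₂ im = inj₂ (proj₂ (img-sem (delNode q) z x nz ex) im)

        edgePresent-sem : ∀ z w x y → node (Src i) z ≡ true → node (Src i) w ≡ true → map μ z ≡ just x → map μ w ≡ just y →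
               Tg.⟦ EdgePresentF i z w ⟧ ρ' ↔ (eH x y ≡ true)
        edgePresent-sem z w x y nz nw ex ey with z F.≟ w
        ... | yes refl with just-inj (trans (sym ex) ey)
        ... | refl = (λ h → let (x' , ex' , e) = proj₁ (loopWit-sem z nz) h in subst (λ v → eH v v ≡ true) (just-inj (trans (sym ex') ex)) e) ,
                     (λ e → proj₂ (loopWit-sem z nz) (x , ex , e))
        edgePresent-sem z w x y nz nw ex ey | no ne =
          (λ h → let (x' , y' , ex' , ey' , e) = proj₁ (edgeWit-sem z w ne nz nw) h in
                 subst₂ (λ u v → eH u v ≡ true) (just-inj (trans (sym ex') ex)) (just-inj (trans (sym ey') ey)) e) ,
          (λ e → proj₂ (edgeWit-sem z w ne nz nw) (x , y , ex , ey , e))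

        edgeBefore-sem : ∀ z w x y → node (Src i) z ≡ true → node (Src i) w ≡ true → map μ z ≡ just x → map μ w ≡ just y →
                 Tg.⟦ EdgeBeforeF i z w ⟧ ρ' ↔ (edge H x y ≡ true)
        proj₁ (edgeBefore-sem z w x y nz nw ex ey) (inj₁ (ep , na)) =
          proj₂ (he x y) (inj₁ (proj₁ (edgePresent-sem z w x y nz nw ex ey) ep , λ im → na (proj₂ (img2-sem (addEdge q) z w x y nz nw ex ey) im)))
        proj₁ (edgeBefore-sem z w x y nz nw ex ey) (inj₂ d) = proj₂ (he x y) (inj₂ (proj₁ (img2-sem (delEdge q) z w x y nz nw ex ey) d))
        proj₂ (edgeBefore-sem z w x y nz nw ex ey) h with proj₁ (he x y) h
        ... | inj₁ (eh , ni) = inj₁ (proj₂ (edgePresent-sem z w x y nz nw ex ey) eh , λ b → ni (proj₁ (img2-sem (addEdge q) z w x y nz nw ex ey) b))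
        ... | inj₂ im = inj₂ (proj₂ (img2-sem (delEdge q) z w x y nz nw ex ey) im)

        defOf : ∀ z → node (Src i) z ≡ true → Tg.⟦ DefinedF i z ⟧ ρ' → Σ (Fin (size H)) λ x → map μ z ≡ just x
        defOf z nz d with proj₁ (nodeWit-sem z co nz) d
        ... | x , ex , _ = x , ex

        defIn : ∀ z x → node (Src i) z ≡ true → map μ z ≡ just x → Tg.⟦ DefinedF i z ⟧ ρ'
        defIn z x nz ex = proj₂ (nodeWit-sem z co nz) (x , ex , tt)

        nEdge→ : ∀ z w x y → node (Src i) z ≡ true → node (Src i) w ≡ true → map μ z ≡ just x → map μ w ≡ just y →
                 ¬ Tg.⟦ EdgeBeforeF i z w ⟧ ρ' → not (edge H x y) ≡ true
        nEdge→ z w x y nz nw ex ey ne = false→not-true (¬true→false (λ e → ne (proj₂ (edgeBefore-sem z w x y nz nw ex ey) e)))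

        nEdge← : ∀ z w x y → node (Src i) z ≡ true → node (Src i) w ≡ true → map μ z ≡ just x → map μ w ≡ just y →
                 not (edge H x y) ≡ true → ¬ Tg.⟦ EdgeBeforeF i z w ⟧ ρ'
        nEdge← z w x y nz nw ex ey h eg = true≢false (proj₁ (edgeBefore-sem z w x y nz nw ex ey) eg) (not-true→false _ h)

        total-host-sem : Tg.⟦ TotalF i host ⟧ ρ' ↔ Sr.Total μ host
        proj₁ total-host-sem (h1 , h2) = u1 , u2
          where
          u1 : ∀ z → node (Src i) z ≡ true → Σ (Fin (size H)) λ x → (map μ z ≡ just x) × (node H x ≡ true)
          u1 z nz with proj₁ (guardA-sem _ _ ρ') (proj₁ (bigAnd-sem _ ρ') h1 z) nz
          ... | d , ng with defOf z nz d
          ... | x , ex = x , ex , proj₁ (nodeBefore-sem z x nz ex) ng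
          u2 : ∀ z w x y → edge (Src i) z w ≡ true → map μ z ≡ just x → map μ w ≡ just y → edge H x y ≡ true
          u2 z w x y ezw ex ey =
            proj₁ (edgeBefore-sem z w x y nz nw ex ey)
              (proj₁ (guardA-sem _ _ ρ') (proj₁ (bigAnd-sem _ ρ') (proj₁ (bigAnd-sem _ ρ') h2 z) w) ezw (defIn z x nz ex , defIn w y nw ey))
            where
            nz : node (Src i) z ≡ true
            nz = edge-src (Src i) z w ezw
            nw : node (Src i) w ≡ true
            nw = edge-tgt (Src i) z w ezw
        proj₂ total-host-sem (u1 , u2) =
          (proj₂ (bigAnd-sem _ ρ') λ z → proj₂ (guardA-sem _ _ ρ') λ nz →
             let (x , ex , nh) = u1 z nz in defIn z x nz ex , proj₂ (nodeBefore-sem z x nz ex) nh) ,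
          (proj₂ (bigAnd-sem _ ρ') λ z → proj₂ (bigAnd-sem _ ρ') λ w → proj₂ (guardA-sem _ _ ρ') λ ezw dd →
             let nz = edge-src (Src i) z w ezw
                 nw = edge-tgt (Src i) z w ezw
                 (x , ex) = defOf z nz (proj₁ dd)
                 (y , ey) = defOf w nw (proj₂ dd)
             in proj₂ (edgeBefore-sem z w x y nz nw ex ey) (u2 z w x y ezw ex ey))

        total-co-sem : Tg.⟦ TotalF i co ⟧ ρ' ↔ Sr.Total μ co
        proj₁ total-co-sem (h1 , h2) = u1 , u2
          where
          u1 : ∀ z → node (Src i) z ≡ true → Σ (Fin (size H)) λ x → (map μ z ≡ just x) × ⊤
          u1 z nz with defOf z nz (proj₁ (guardA-sem _ _ ρ') (proj₁ (bigAnd-sem _ ρ') h1 z) nz)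
          ... | x , ex = x , ex , tt
          u2 : ∀ z w x y → edge (Src i) z w ≡ true → map μ z ≡ just x → map μ w ≡ just y → not (edge H x y) ≡ true
          u2 z w x y ezw ex ey =
            nEdge→ z w x y nz nw ex ey
              (proj₁ (guardA-sem _ _ ρ') (proj₁ (bigAnd-sem _ ρ') (proj₁ (bigAnd-sem _ ρ') h2 z) w) ezw (defIn z x nz ex , defIn w y nw ey))
            where
            nz : node (Src i) z ≡ true
            nz = edge-src (Src i) z w ezw
            nw : node (Src i) w ≡ true
            nw = edge-tgt (Src i) z w ezw
        proj₂ total-co-sem (u1 , u2) =
          (proj₂ (bigAnd-sem _ ρ') λ z → proj₂ (guardA-sem _ _ ρ') λ nz →
             let (x , ex , _) = u1 z nz in defIn z x nz ex) ,
          (proj₂ (bigAnd-sem _ ρ') λ z → proj₂ (bigAnd-sem _ ρ') λ w → proj₂ (guardA-sem _ _ ρ') λ ezw dd →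
             let nz = edge-src (Src i) z w ezw
                 nw = edge-tgt (Src i) z w ezw
                 (x , ex) = defOf z nz (proj₁ dd)
                 (y , ey) = defOf w nw (proj₂ dd)
             in nEdge← z w x y nz nw ex ey (u2 z w x y ezw ex ey))

        total-sem : ∀ t → Tg.⟦ TotalF i t ⟧ ρ' ↔ Sr.Total μ t
        total-sem host = total-host-sem
        total-sem co = total-co-sem

        holdsEq : ∀ t z w x y → node (Src i) z ≡ true → node (Src i) w ≡ true → map μ z ≡ just x → map μ w ≡ just y →
                  Tg.⟦ holdsF t (EdgeBeforeF i z w) ⟧ ρ' ↔ (holds t (edge H x y) ≡ true)
        holdsEq host z w x y nz nw ex ey = edgeBefore-sem z w x y nz nw ex ey
        holdsEq co z w x y nz nw ex ey = nEdge→ z w x y nz nw ex ey , nEdge← z w x y nz nw ex ey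

        someEdge-sem : ∀ t → Tg.⟦ SomeEdgeF i t ⟧ ρ' ↔ Sr.OnSomeEdge μ t
        proj₁ (someEdge-sem t) h with proj₁ (bigOr-sem _ ρ') h
        ... | z , h' with proj₁ (bigOr-sem _ ρ') h'
        ... | w , g with proj₁ (guardO-sem (edge (Src i) z w) (DefinedF i z ∧F (DefinedF i w ∧F holdsF t (EdgeBeforeF i z w))) ρ') g
        ... | ezw , (dz , (dw , hf)) with defOf z (edge-src (Src i) z w ezw) dz | defOf w (edge-tgt (Src i) z w ezw) dw
        ... | x , ex | y , ey = z , w , x , y , ezw , ex , ey ,
                                proj₁ (holdsEq t z w x y (edge-src (Src i) z w ezw) (edge-tgt (Src i) z w ezw) ex ey) hf
        proj₂ (someEdge-sem t) (z , w , x , y , ezw , ex , ey , hh) =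
          proj₂ (bigOr-sem _ ρ') (z , proj₂ (bigOr-sem _ ρ') (w , proj₂ (guardO-sem (edge (Src i) z w) (DefinedF i z ∧F (DefinedF i w ∧F holdsF t (EdgeBeforeF i z w))) ρ')
            (ezw , defIn z x nz ex , defIn w y nw ey , proj₂ (holdsEq t z w x y nz nw ex ey) hh)))
          where
          nz : node (Src i) z ≡ true
          nz = edge-src (Src i) z w ezw
          nw : node (Src i) w ≡ true
          nw = edge-tgt (Src i) z w ezw

      module _ (j : Fin na) (nl : ¬ (src (srcArrow j) ≡ tgt (srcArrow j)))
               (μs : PMap (Src (src (srcArrow j))) H) (μs' : PMap (Tgt (place (copy (src (srcArrow j))))) H')
               (es : ρ' (place (copy (src (srcArrow j)))) ≡ just μs') (rps : Agree μs μs')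
               (μt : PMap (Src (tgt (srcArrow j))) H) (μt' : PMap (Tgt (place (copy (tgt (srcArrow j))))) H')
               (et : ρ' (place (copy (tgt (srcArrow j)))) ≡ just μt') (rpt : Agree μt μt') where
        private
          s0 t0 : Fin k
          s0 = src (srcArrow j)
          t0 = tgt (srcArrow j)
          f : PMor (Src s0) (Src t0)
          f = mor (srcArrow j)

        arrowWit-sem : Tg.⟦ ∃F (place (arrowWit j)) ⊤F ⟧ ρ' ↔ (∀ a b → map (pmap f) a ≡ just b → map μs a ≡ map μt b)
        proj₁ arrowWit-sem h a b fa with proj₁ (wit-sem (arrowWit j)) h
        ... | ν1 , cd = trans (AtCopy.fromCopy s0 μs μs' es rps (arrowWit j) ν1 refl cd a b r1)
                              (sym (AtCopy.fromCopy t0 μt μt' et rpt (arrowWit j) ν1 refl cd b b r2))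
          where
          fr : arrowRel j (toℕ a) (toℕ b) ≡ true
          fr = anyFin-intro _ a (∧-intro (eqN-complete _ _ refl) (subst (λ v → mEq v (toℕ b) ≡ true) (sym fa) (eqN-complete _ _ refl)))
          r1 : relFromCopy s0 (arrowWit j) (toℕ a) (toℕ b) ≡ true
          r1 rewrite ≟-refute s0 t0 nl | ≟-refl s0 = ∨-introˡ _ _ fr
          r2 : relFromCopy t0 (arrowWit j) (toℕ b) (toℕ b) ≡ true
          r2 rewrite ≟-refute s0 t0 nl | ≟-refl t0 | eqN-complete (toℕ b) (toℕ b) refl =
            ∨-introʳ (⌊ t0 F.≟ s0 ⌋ ∧ arrowRel j (toℕ b) (toℕ b)) _ (nodeℕ-complete (Src t0) b (lands f a b fa))
        proj₂ arrowWit-sem hc = proj₂ (wit-sem (arrowWit j)) (toH' μt , cd)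
          where
          cd : CompatibleWit ρ' (arrowWit j) (toH' μt)
          cd s v ν es' a b1 h with entryRel-into-slot (entry s) (arrowWit j) _ _ h
          ... | inj₁ (_ , ())
          ... | inj₂ (i' , eD , r) with arrowWitRel-cases i' j _ _ r
          ... | inj₁ (ei , fr) with arrowRel-sound j _ _ fr
          ... | a1 , ea1 , x1 , mx1 , tx1 with toℕ-injective {i = x1} {j = b1} tx1
          ... | refl = trans (AtCopy.viaCopy s0 μs μs' es rps s i' ν eD es' ei a a1 (sym ea1)) (hc a1 x1 mx1)
          cd s v ν es' a b1 h | inj₂ (i' , eD , r) | inj₂ (ei , ea) =
            AtCopy.viaCopy t0 μt μt' et rpt s i' ν eD es' ei a b1 ea

      module _ (μ0' : PMap (Tgt (place (copy zero))) H') (e0 : ρ' (place (copy zero)) ≡ just μ0') where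
        matchL-sem : Tg.⟦ ∃F (place matchL) ⊤F ⟧ ρ' ↔
              (∀ a (a' : Fin (size (Tgt (place (copy zero))))) → toℕ a' ≡ toℕ a → VL q a ≡ true → map μ0' a' ≡ just (m a))
        proj₁ matchL-sem h a a' ta va with proj₁ (wit-sem matchL) h
        ... | ν1 , cd = trans (cd (place (copy zero)) (copy-hasArrow zero matchL refl) μ0' e0 a' a rl)
                              (trans (sym (cd (suc zero) (K-hasArrow matchL refl) Kmatch kt a a rk)) (matchMap-defined K⁻¹ H' m m-inj m-typed a (covR a)))
          where
          rl : entryRel (entry (place (copy zero))) (slot matchL) (toℕ a') (toℕ a) ≡ true
          rl = subst (λ X → entryRel X (slot matchL) (toℕ a') (toℕ a) ≡ true) (sym (entry-place (copy zero)))
                 (∧-intro (≟-refl {k} zero) (∧-intro (eqN-complete _ _ ta) (nodeℕ-complete (LHS q) a va)))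
          rk : relFromK matchL (toℕ a) (toℕ a) ≡ true
          rk = ∧-intro (eqN-complete _ _ refl) (nodeℕ-complete (LHS q) a va)
        proj₂ matchL-sem hyp = proj₂ (wit-sem matchL) (ν1 , cd)
          where
          ν1 : PMap (LHS q) H'
          ν1 = matchMap (LHS q) H' m m-inj m-typed
          cd : CompatibleWit ρ' matchL ν1
          cd s v ν es a b1 h with entryRel-into-slot (entry s) matchL _ _ h
          ... | inj₁ (eK , r) = trans (ktView s ν eK es a b1 (eqN-sound _ _ (∧-l _ _ r)))
                                      (sym (matchMap-defined (LHS q) H' m m-inj m-typed b1 (nodeℕ-sound (LHS q) b1 (∧-r (eqN (toℕ a) (toℕ b1)) _ r))))
          ... | inj₂ (i' , eD , r) with guardedId-sound i' zero (LHS q) _ _ r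
          ... | refl , ea , nd with copyView s zero ν eD es
          ... | ν' , ec' , hv with trans (sym e0) ec'
          ... | refl with castFin (sym (Tgt-place (copy zero))) b1
          ... | a'' , ta'' = trans (hv a a'' (trans ea (sym ta'')))
                                   (trans (hyp b1 a'' ta'' (nodeℕ-sound (LHS q) b1 nd))
                                          (sym (matchMap-defined (LHS q) H' m m-inj m-typed b1 (nodeℕ-sound (LHS q) b1 nd))))

      module _ (μ1' : PMap (Tgt (place (copy (suc zero)))) H') (e1 : ρ' (place (copy (suc zero))) ≡ just μ1') where
        matchK-sem : Tg.⟦ ∃F (place matchK) ⊤F ⟧ ρ' ↔
              (∀ a (a' : Fin (size (Tgt (place (copy (suc zero)))))) → toℕ a' ≡ toℕ a → Knode q a ≡ true → map μ1' a' ≡ just (m a))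
        proj₁ matchK-sem h a a' ta va with proj₁ (wit-sem matchK) h
        ... | ν1 , cd = trans (cd (place (copy (suc zero))) (copy-hasArrow (suc zero) matchK refl) μ1' e1 a' a rl)
                              (trans (sym (cd (suc zero) (K-hasArrow matchK refl) Kmatch kt a a rk)) (matchMap-defined K⁻¹ H' m m-inj m-typed a (covR a)))
          where
          rl : entryRel (entry (place (copy (suc zero)))) (slot matchK) (toℕ a') (toℕ a) ≡ true
          rl = subst (λ X → entryRel X (slot matchK) (toℕ a') (toℕ a) ≡ true) (sym (entry-place (copy (suc zero))))
                 (∧-intro (≟-refl {k} (suc zero)) (∧-intro (eqN-complete _ _ ta) (nodeℕ-complete (Nih q) a va)))
          rk : relFromK matchK (toℕ a) (toℕ a) ≡ true
          rk = ∧-intro (eqN-complete _ _ refl) (nodeℕ-complete (Nih q) a va)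
        proj₂ matchK-sem hyp = proj₂ (wit-sem matchK) (ν1 , cd)
          where
          ν1 : PMap (Nih q) H'
          ν1 = matchMap (Nih q) H' m m-inj m-typed
          cd : CompatibleWit ρ' matchK ν1
          cd s v ν es a b1 h with entryRel-into-slot (entry s) matchK _ _ h
          ... | inj₁ (eK , r) = trans (ktView s ν eK es a b1 (eqN-sound _ _ (∧-l _ _ r)))
                                      (sym (matchMap-defined (Nih q) H' m m-inj m-typed b1 (nodeℕ-sound (Nih q) b1 (∧-r (eqN (toℕ a) (toℕ b1)) _ r))))
          ... | inj₂ (i' , eD , r) with guardedId-sound i' (suc zero) (Nih q) _ _ r
          ... | refl , ea , nd with copyView s (suc zero) ν eD es
          ... | ν' , ec' , hv with trans (sym e1) ec'
          ... | refl with castFin (sym (Tgt-place (copy (suc zero)))) b1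
          ... | a'' , ta'' = trans (hv a a'' (trans ea (sym ta'')))
                                   (trans (hyp b1 a'' ta'' (nodeℕ-sound (Nih q) b1 nd))
                                          (sym (matchMap-defined (Nih q) H' m m-inj m-typed b1 (nodeℕ-sound (Nih q) b1 nd))))

    fromH' : ∀ {A : Graph T} → PMap A H' → PMap A H
    fromH' μ = record { map = map μ ; injective = injective μ ; typed = typed μ ; on-nodes = on-nodes μ }

    toCopy : ∀ i → PMap (Src i) H → PMap (Tgt (copyIx i)) H'
    toCopy i μ = castPM (sym (Tgt-place (copy i))) (toH' μ)

    toCopy-agrees : ∀ i (μ : PMap (Src i) H) → Agree μ (toCopy i μ)
    toCopy-agrees i μ a a' h = sym (castPM-map (sym (Tgt-place (copy i))) (toH' μ) a a' h)

    fromCopy' : ∀ i → PMap (Tgt (copyIx i)) H' → PMap (Src i) H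
    fromCopy' i μ' = fromH' (castPM (Tgt-place (copy i)) μ')

    fromCopy'-agrees : ∀ i (μ' : PMap (Tgt (copyIx i)) H') → Agree (fromCopy' i μ') μ'
    fromCopy'-agrees i μ' a a' h = castPM-map (Tgt-place (copy i)) μ' a' a (sym h)

    slot-injective : ∀ {d d'} → slot d ≡ slot d' → d ≡ d'
    slot-injective refl = refl

    copy-injective : ∀ {i j} → copy i ≡ copy j → i ≡ j
    copy-injective refl = refl

    place-injective : ∀ d d' → place d ≡ place d' → d ≡ d'
    place-injective d d' e = slot-injective (trans (sym (entry-place d)) (trans (cong entry e) (entry-place d')))

    copyIx-injective : ∀ i j → copyIx i ≡ copyIx j → i ≡ j
    copyIx-injective i j e = copy-injective (place-injective (copy i) (copy j) e)

    copyIx-not-sink : ∀ i x → isSink (entry x) ≡ true → ¬ (copyIx i ≡ x)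
    copyIx-not-sink i .(copyIx i) h refl = true≢false h (cong isSink (entry-place (copy i)))

    copyIx-not-K : ∀ i → ¬ (copyIx i ≡ suc zero)
    copyIx-not-K i ()

    -- The invariant of the induction over formulas: the graphs bound in ρ are
    -- exactly those marked in B, their copies are bound in ρ' to agreeing maps,
    -- no sink is bound, and K of q⁻¹ is bound to the match.
    record Corresponds (B : Fin k → Bool) (ρ : Sr.Env) (ρ' : Tg.Env) : Set where
      field
        sf : SinksUnbound ρ'
        kt : ρ' (suc zero) ≡ just Kmatch
        unb : ∀ i → B i ≡ false → (ρ i ≡ nothing) × (ρ' (copyIx i) ≡ nothing)
        bnd : ∀ i → B i ≡ true → Σ (PMap (Src i) H) λ μ → (ρ i ≡ just μ) ×
                Σ (PMap (Tgt (copyIx i)) H') λ μ' → (ρ' (copyIx i) ≡ just μ') × Agree μ μ'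

    bind-true : ∀ B i j → bind B i j ≡ true → (i ≡ j) ⊎ ((¬ i ≡ j) × (B j ≡ true))
    bind-true B i j h = go (i F.≟ j) h
      where
      go : (d : Dec (i ≡ j)) → (if ⌊ d ⌋ then true else B j) ≡ true → (i ≡ j) ⊎ ((¬ i ≡ j) × (B j ≡ true))
      go (yes e) _ = inj₁ e
      go (no ne) h' = inj₂ (ne , h')

    bind-false : ∀ B i j → bind B i j ≡ false → (¬ i ≡ j) × (B j ≡ false)
    bind-false B i j h = go (i F.≟ j) h
      where
      go : (d : Dec (i ≡ j)) → (if ⌊ d ⌋ then true else B j) ≡ false → (¬ i ≡ j) × (B j ≡ false)
      go (yes e) ()
      go (no ne) h' = ne , h'

    corresponds-update : ∀ {B ρ ρ'} → Corresponds B ρ ρ' → ∀ i μ μ' → Agree μ μ' → Corresponds (bind B i) (Sr.update ρ i μ) (Tg.update ρ' (copyIx i) μ')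
    corresponds-update {B} {ρ} {ρ'} c i μ μ' rp = record { sf = sf' ; kt = kt' ; unb = unb' ; bnd = bnd' }
      where
      module c = Corresponds c
      sf' : SinksUnbound (Tg.update ρ' (copyIx i) μ')
      sf' x h = trans (upd-other ρ' (copyIx i) μ' x (copyIx-not-sink i x h)) (c.sf x h)
      kt' : Tg.update ρ' (copyIx i) μ' (suc zero) ≡ just Kmatch
      kt' = trans (upd-other ρ' (copyIx i) μ' (suc zero) (copyIx-not-K i)) c.kt
      unb' : ∀ j → bind B i j ≡ false → (Sr.update ρ i μ j ≡ nothing) × (Tg.update ρ' (copyIx i) μ' (copyIx j) ≡ nothing)
      unb' j h with bind-false B i j h
      ... | ne , bj = trans (Supd-other ρ i μ j ne) (proj₁ (c.unb j bj)) ,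
                      trans (upd-other ρ' (copyIx i) μ' (copyIx j) (λ e → ne (copyIx-injective i j e))) (proj₂ (c.unb j bj))
      bnd' : ∀ j → bind B i j ≡ true → Σ (PMap (Src j) H) λ μ₁ → (Sr.update ρ i μ j ≡ just μ₁) ×
               Σ (PMap (Tgt (copyIx j)) H') λ μ₁' → (Tg.update ρ' (copyIx i) μ' (copyIx j) ≡ just μ₁') × Agree μ₁ μ₁'
      bnd' j h with bind-true B i j h
      ... | inj₁ refl = μ , Supd-same ρ i μ , μ' , upd-same ρ' (copyIx i) μ' , rp
      ... | inj₂ (ne , bj) with c.bnd j bj
      ... | μ₁ , e₁ , μ₁' , e₁' , rp₁ = μ₁ , trans (Supd-other ρ i μ j ne) e₁ , μ₁' ,
                                        trans (upd-other ρ' (copyIx i) μ' (copyIx j) (λ e → ne (copyIx-injective i j e))) e₁' , rp₁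

    empty-path-subst : ∀ {i l} (e : i ≡ l) a → compose (subst (Path Src srcArrow i) e []) a ≡ just (subst (λ x → Fin (size (Src x))) e a)
    empty-path-subst refl a = refl

    same-binding : ∀ (ρ : Sr.Env) {i l} (e : i ≡ l) (μ : PMap (Src i) H) (ν : PMap (Src l) H) → ρ i ≡ just μ → ρ l ≡ just ν →
            ∀ a → map μ a ≡ map ν (subst (λ x → Fin (size (Src x))) e a)
    same-binding ρ refl μ ν es et a with trans (sym es) et
    ... | refl = refl

    -- A loop of C is the identity because C commutes, so it never obstructs
    -- compatibility; the translation therefore checks non-loops only.
    loop-compatible : ∀ (ρ : Sr.Env) (j : Fin na) → src (srcArrow j) ≡ tgt (srcArrow j) → ∀ μ ν → ρ (src (srcArrow j)) ≡ just μ → ρ (tgt (srcArrow j)) ≡ just ν →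
            ∀ a b → map (pmap (mor (srcArrow j))) a ≡ just b → map μ a ≡ map ν b
    loop-compatible ρ j e μ ν es et a b fa =
      trans (same-binding ρ e μ ν es et a) (cong (map ν) (sym (just-inj (trans (sym fa) cm))))
      where
      cm : map (pmap (mor (srcArrow j))) a ≡ just (subst (λ x → Fin (size (Src x))) e a)
      cm = trans (sym (bind-id (map (pmap (mor (srcArrow j))) a) just (λ _ → refl)))
                 (trans (commutes C (src (srcArrow j)) (tgt (srcArrow j)) (j ∷ []) (subst (Path Src srcArrow (src (srcArrow j))) e []) a) (empty-path-subst e a))

    compatible-sem : ∀ {B ρ ρ'} → Corresponds B ρ ρ' → Sr.Compatible ρ ↔ Tg.⟦ CompatibleF B ⟧ ρ'
    proj₁ (compatible-sem {B} {ρ} {ρ'} c) comp = proj₂ (bigAnd-sem _ ρ') λ j → proj₂ (guardA-sem _ _ ρ') λ g → go j g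
      where
      module c = Corresponds c
      go : ∀ j → (B (src (srcArrow j)) ∧ (B (tgt (srcArrow j)) ∧ not ⌊ src (srcArrow j) F.≟ tgt (srcArrow j) ⌋)) ≡ true → Tg.⟦ ∃F (place (arrowWit j)) ⊤F ⟧ ρ'
      go j g with ∧3 (B (src (srcArrow j))) (B (tgt (srcArrow j))) (not ⌊ src (srcArrow j) F.≟ tgt (srcArrow j) ⌋) g
      ... | bs , bt , nl with c.bnd _ bs | c.bnd _ bt
      ... | μs , es , μs' , es' , rps | μt , et , μt' , et' , rpt =
        proj₂ (WitnessSemantics.arrowWit-sem ρ' c.sf c.kt j (λ e → true≢false (≟-complete _ _ e) (not-true→false _ nl)) μs μs' es' rps μt μt' et' rpt)
              (λ a b fa → comp j μs μt es et a b fa)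
    proj₂ (compatible-sem {B} {ρ} {ρ'} c) h j μ ν es et a b fa with bool-cases (B (src (srcArrow j))) | bool-cases (B (tgt (srcArrow j)))
    ... | inj₂ f | _ = ⊥-elim (nothing≢just (trans (sym (proj₁ (Corresponds.unb c _ f))) es))
    ... | inj₁ _ | inj₂ f = ⊥-elim (nothing≢just (trans (sym (proj₁ (Corresponds.unb c _ f))) et))
    ... | inj₁ bs | inj₁ bt with src (srcArrow j) F.≟ tgt (srcArrow j)
    ... | yes e = loop-compatible ρ j e μ ν es et a b fa
    ... | no nl with Corresponds.bnd c _ bs | Corresponds.bnd c _ bt
    ... | μs , es₁ , μs' , es' , rps | μt , et₁ , μt' , et' , rpt with trans (sym es) es₁ | trans (sym et) et₁
    ... | refl | refl =
      proj₁ (WitnessSemantics.arrowWit-sem ρ' (Corresponds.sf c) (Corresponds.kt c) j nl μs μs' es' rps μt μt' et' rpt)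
            (proj₁ (guardA-sem _ _ ρ') (proj₁ (bigAnd-sem _ ρ') h j) (∧-intro bs (∧-intro bt (false→not-true (≟-refute _ _ nl))))) a b fa

    atomP : ∀ B ρ ρ' → Corresponds B ρ ρ' → ∀ i t b → B i ≡ b → Sr.⟦ P i t ⟧ ρ ↔ Tg.⟦ if b then TotalF i t else ⊥F ⟧ ρ'
    atomP B ρ ρ' c i t true eb with Corresponds.bnd c i eb
    ... | μ , es , μ' , ec , rp =
      (λ { (μ₀ , e₀ , tot) → proj₂ (TT.total-sem t) (subst (λ v → Sr.Total v t) (just-inj (trans (sym e₀) es)) tot) }) ,
      (λ h → μ , es , proj₁ (TT.total-sem t) h)
      where module TT = WitnessSemantics.AtCopy ρ' (Corresponds.sf c) (Corresponds.kt c) i μ μ' ec rp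
    atomP B ρ ρ' c i t false eb =
      (λ { (μ₀ , e₀ , _) → ⊥-elim (nothing≢just (trans (sym (proj₁ (Corresponds.unb c i eb))) e₀)) }) , (λ h → ⊥-elim (⊥F-e ρ' h))

    atomQ : ∀ B ρ ρ' → Corresponds B ρ ρ' → ∀ i t b → B i ≡ b → Sr.⟦ Q i t ⟧ ρ ↔ Tg.⟦ if b then SomeEdgeF i t else ⊥F ⟧ ρ'
    atomQ B ρ ρ' c i t true eb with Corresponds.bnd c i eb
    ... | μ , es , μ' , ec , rp =
      (λ { (μ₀ , e₀ , tot) → proj₂ (TT.someEdge-sem t) (subst (λ v → Sr.OnSomeEdge v t) (just-inj (trans (sym e₀) es)) tot) }) ,
      (λ h → μ , es , proj₁ (TT.someEdge-sem t) h)
      where module TT = WitnessSemantics.AtCopy ρ' (Corresponds.sf c) (Corresponds.kt c) i μ μ' ec rp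
    atomQ B ρ ρ' c i t false eb =
      (λ { (μ₀ , e₀ , _) → ⊥-elim (nothing≢just (trans (sym (proj₁ (Corresponds.unb c i eb))) e₀)) }) , (λ h → ⊥-elim (⊥F-e ρ' h))

    bind-source : ∀ {B ρ ρ'} → Corresponds B ρ ρ' → ∀ i (μ : PMap (Src i) H) →
                  Corresponds (bind B i) (Sr.update ρ i μ) (Tg.update ρ' (copyIx i) (toCopy i μ))
    bind-source c i μ = corresponds-update c i μ (toCopy i μ) (toCopy-agrees i μ)

    bind-copy : ∀ {B ρ ρ'} → Corresponds B ρ ρ' → ∀ i (μ' : PMap (Tgt (copyIx i)) H') →
                Corresponds (bind B i) (Sr.update ρ i (fromCopy' i μ')) (Tg.update ρ' (copyIx i) μ')
    bind-copy c i μ' = corresponds-update c i (fromCopy' i μ') μ' (fromCopy'-agrees i μ')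

    translate-correct : ∀ φ B ρ ρ' → Corresponds B ρ ρ' → Sr.⟦ φ ⟧ ρ ↔ Tg.⟦ translate B φ ⟧ ρ'
    translate-correct (P i t) B ρ ρ' c = atomP B ρ ρ' c i t (B i) refl
    translate-correct (Q i t) B ρ ρ' c = atomQ B ρ ρ' c i t (B i) refl
    translate-correct (¬F φ) B ρ ρ' c = (λ h h' → h (proj₂ (translate-correct φ B ρ ρ' c) h')) , (λ h h' → h (proj₁ (translate-correct φ B ρ ρ' c) h'))
    translate-correct (φ ∧F ψ) B ρ ρ' c =
      (λ { (a , b) → proj₁ (translate-correct φ B ρ ρ' c) a , proj₁ (translate-correct ψ B ρ ρ' c) b }) ,
      (λ { (a , b) → proj₂ (translate-correct φ B ρ ρ' c) a , proj₂ (translate-correct ψ B ρ ρ' c) b })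
    translate-correct (φ ∨F ψ) B ρ ρ' c =
      (λ { (inj₁ a) → inj₁ (proj₁ (translate-correct φ B ρ ρ' c) a) ; (inj₂ b) → inj₂ (proj₁ (translate-correct ψ B ρ ρ' c) b) }) ,
      (λ { (inj₁ a) → inj₁ (proj₂ (translate-correct φ B ρ ρ' c) a) ; (inj₂ b) → inj₂ (proj₂ (translate-correct ψ B ρ ρ' c) b) })
    translate-correct (φ ⇒F ψ) B ρ ρ' c =
      (λ h a → proj₁ (translate-correct ψ B ρ ρ' c) (h (proj₂ (translate-correct φ B ρ ρ' c) a))) ,
      (λ h a → proj₂ (translate-correct ψ B ρ ρ' c) (h (proj₁ (translate-correct φ B ρ ρ' c) a)))
    translate-correct (∀F i φ) B ρ ρ' c = fw , bw
      where
      fw : Sr.⟦ ∀F i φ ⟧ ρ → Tg.⟦ translate B (∀F i φ) ⟧ ρ'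
      fw h μ' _ sc = proj₁ (translate-correct φ (bind B i) _ _ c') (h (fromCopy' i μ') (proj₂ (compatible-sem c') sc))
        where
        c' : Corresponds (bind B i) (Sr.update ρ i (fromCopy' i μ')) (Tg.update ρ' (copyIx i) μ')
        c' = bind-copy c i μ'
      bw : Tg.⟦ translate B (∀F i φ) ⟧ ρ' → Sr.⟦ ∀F i φ ⟧ ρ
      bw h μ comp = proj₂ (translate-correct φ (bind B i) _ _ c')
                          (h (toCopy i μ) (sinks-unbound-compatible _ (Corresponds.sf c')) (proj₁ (compatible-sem c') comp))
        where
        c' : Corresponds (bind B i) (Sr.update ρ i μ) (Tg.update ρ' (copyIx i) (toCopy i μ))
        c' = bind-source c i μ
    translate-correct (∃F i φ) B ρ ρ' c = fw , bw
      where
      fw : Sr.⟦ ∃F i φ ⟧ ρ → Tg.⟦ translate B (∃F i φ) ⟧ ρ'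
      fw (μ , comp , h) = toCopy i μ , sinks-unbound-compatible _ (Corresponds.sf c') , proj₁ (compatible-sem c') comp ,
                          proj₁ (translate-correct φ (bind B i) _ _ c') h
        where
        c' : Corresponds (bind B i) (Sr.update ρ i μ) (Tg.update ρ' (copyIx i) (toCopy i μ))
        c' = bind-source c i μ
      bw : Tg.⟦ translate B (∃F i φ) ⟧ ρ' → Sr.⟦ ∃F i φ ⟧ ρ
      bw (μ' , _ , sc , h) = fromCopy' i μ' , proj₂ (compatible-sem c') sc , proj₂ (translate-correct φ (bind B i) _ _ c') h
        where
        c' : Corresponds (bind B i) (Sr.update ρ i (fromCopy' i μ')) (Tg.update ρ' (copyIx i) μ')
        c' = bind-copy c i μ'

    Lm : PMap (LHS q) H
    Lm = matchMap (LHS q) H m m-inj m-typed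
    Km : PMap (Nih q) H
    Km = matchMap (Nih q) H m m-inj m-typed

    sinks-unbound-update : ∀ ρ i μ' → SinksUnbound ρ → SinksUnbound (Tg.update ρ (copyIx i) μ')
    sinks-unbound-update ρ i μ' sf x h = trans (upd-other ρ (copyIx i) μ' x (copyIx-not-sink i x h)) (sf x h)

    module _ (i₀ : Fin k) (f : Fin (size (Src i₀)) → Fin (size H))
             (f-inj : ∀ a b → f a ≡ f b → a ≡ b) (f-typed : ∀ a → type H (f a) ≡ type (Src i₀) a)
             (μ' : PMap (Tgt (copyIx i₀)) H') where
      AgreesWith : Set
      AgreesWith = ∀ a (a' : Fin (size (Tgt (copyIx i₀)))) → toℕ a' ≡ toℕ a → node (Src i₀) a ≡ true → map μ' a' ≡ just (f a)

      agrees→corresponds : AgreesWith → Agree (matchMap (Src i₀) H f f-inj f-typed) μ'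
      agrees→corresponds h a a' e with bool-cases (node (Src i₀) a)
      ... | inj₁ v = trans (matchMap-defined (Src i₀) H f f-inj f-typed a v) (sym (h a a' (sym e) v))
      ... | inj₂ v = trans (matchMap-undefined (Src i₀) H f f-inj f-typed a v) (sym undefined)
        where
        undefined : map μ' a' ≡ nothing
        undefined with map μ' a' in em
        ... | nothing = refl
        ... | just x = ⊥-elim (true≢false (trans (sym (castNode (Tgt-place (copy i₀)) a' a (sym e))) (on-nodes μ' a' x em)) v)

      corresponds→agrees : Agree (matchMap (Src i₀) H f f-inj f-typed) μ' → AgreesWith
      corresponds→agrees rp a a' e v = trans (sym (rp a a' (sym e))) (matchMap-defined (Src i₀) H f f-inj f-typed a v)

    module Initial (ρ0 : Sr.Env) (ρ0' : Tg.Env) (e0 : ρ0 zero ≡ just Lm) (e1 : ρ0 (suc zero) ≡ just Km)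
               (eN : ∀ y → ρ0 (suc (suc y)) ≡ nothing) (eK : ρ0' (suc zero) ≡ just Kmatch)
               (eN' : ∀ y → ρ0' (suc (suc y)) ≡ nothing) where

      sf0 : SinksUnbound ρ0'
      sf0 zero ()
      sf0 (suc zero) ()
      sf0 (suc (suc y)) _ = eN' y

      C01 : ¬ (copyIx (suc zero) ≡ copyIx zero)
      C01 e with copyIx-injective (suc zero) zero e
      ... | ()

      module CopiesBound (μ0' : PMap (Tgt (copyIx zero)) H') (μ1' : PMap (Tgt (copyIx (suc zero))) H') where
        ρ1 ρ2 : Tg.Env
        ρ1 = Tg.update ρ0' (copyIx zero) μ0'
        ρ2 = Tg.update ρ1 (copyIx (suc zero)) μ1'

        sf1 : SinksUnbound ρ1
        sf1 = sinks-unbound-update ρ0' zero μ0' sf0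
        sf2 : SinksUnbound ρ2
        sf2 = sinks-unbound-update ρ1 (suc zero) μ1' sf1

        kt1 : ρ1 (suc zero) ≡ just Kmatch
        kt1 = trans (upd-other ρ0' (copyIx zero) μ0' (suc zero) (copyIx-not-K zero)) eK
        kt2 : ρ2 (suc zero) ≡ just Kmatch
        kt2 = trans (upd-other ρ1 (copyIx (suc zero)) μ1' (suc zero) (copyIx-not-K (suc zero))) kt1

        matchL↔ : Tg.⟦ ∃F (place matchL) ⊤F ⟧ ρ1 ↔ AgreesWith zero m m-inj m-typed μ0'
        matchL↔ = WitnessSemantics.matchL-sem ρ1 sf1 kt1 μ0' (upd-same ρ0' (copyIx zero) μ0')

        matchK↔ : Tg.⟦ ∃F (place matchK) ⊤F ⟧ ρ2 ↔ AgreesWith (suc zero) m m-inj m-typed μ1'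
        matchK↔ = WitnessSemantics.matchK-sem ρ2 sf2 kt2 μ1' (upd-same ρ1 (copyIx (suc zero)) μ1')

        corr : Agree Lm μ0' → Agree Km μ1' → Corresponds initiallyBound ρ0 ρ2
        corr rp0 rp1 = record { sf = sf2 ; kt = kt2 ; unb = unb' ; bnd = bnd' }
          where
          unb' : ∀ j → initiallyBound j ≡ false → (ρ0 j ≡ nothing) × (ρ2 (copyIx j) ≡ nothing)
          unb' zero ()
          unb' (suc zero) ()
          unb' (suc (suc y)) _ =
            eN y , trans (upd-other ρ1 (copyIx (suc zero)) μ1' (copyIx (suc (suc y))) (λ e → s≢ (copyIx-injective _ _ e)))
                         (trans (upd-other ρ0' (copyIx zero) μ0' (copyIx (suc (suc y))) (λ e → z≢ (copyIx-injective _ _ e))) (eN' _))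
            where
            s≢ : ¬ (suc {n = 1 ℕ.+ extra C} zero ≡ suc (suc y))
            s≢ ()
            z≢ : ¬ (zero ≡ suc (suc y))
            z≢ ()
          bnd' : ∀ j → initiallyBound j ≡ true → Σ (PMap (Src j) H) λ μ → (ρ0 j ≡ just μ) ×
                   Σ (PMap (Tgt (copyIx j)) H') λ μ' → (ρ2 (copyIx j) ≡ just μ') × Agree μ μ'
          bnd' zero _ = Lm , e0 , μ0' , trans (upd-other ρ1 (copyIx (suc zero)) μ1' (copyIx zero) C01) (upd-same ρ0' (copyIx zero) μ0') , rp0
          bnd' (suc zero) _ = Km , e1 , μ1' , upd-same ρ1 (copyIx (suc zero)) μ1' , rp1
          bnd' (suc (suc y)) ()

      -- Forwards the copies are bound to the match maps themselves; backwards
      -- matchL, matchK force the chosen copies to agree with them.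
      initial-correct : Sr.⟦ formula C ⟧ ρ0 ↔ Tg.⟦ translatedFormula ⟧ ρ0'
      proj₁ initial-correct h =
        μ0' , sinks-unbound-compatible ρ1 sf1 , proj₂ matchL↔ (corresponds→agrees zero m m-inj m-typed μ0' rp0) ,
        μ1' , sinks-unbound-compatible ρ2 sf2 , proj₂ matchK↔ (corresponds→agrees (suc zero) m m-inj m-typed μ1' rp1) ,
        proj₁ (translate-correct (formula C) initiallyBound ρ0 ρ2 (corr rp0 rp1)) h
        where
        μ0' : PMap (Tgt (copyIx zero)) H'
        μ0' = toCopy zero Lm
        μ1' : PMap (Tgt (copyIx (suc zero))) H'
        μ1' = toCopy (suc zero) Km
        rp0 : Agree Lm μ0'
        rp0 = toCopy-agrees zero Lm
        rp1 : Agree Km μ1'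
        rp1 = toCopy-agrees (suc zero) Km
        open CopiesBound μ0' μ1'
      proj₂ initial-correct (μ0' , _ , isL , μ1' , _ , isK , hφ) =
        proj₂ (translate-correct (formula C) initiallyBound ρ0 ρ2 (corr rp0 rp1)) hφ
        where
        open CopiesBound μ0' μ1'
        rp0 : Agree Lm μ0'
        rp0 = agrees→corresponds zero m m-inj m-typed μ0' (proj₁ matchL↔ isL)
        rp1 : Agree Km μ1'
        rp1 = agrees→corresponds (suc zero) m m-inj m-typed μ1' (proj₁ matchK↔ isK)

-- From a precondition to an equivalent postcondition: translate along p.
-- G is the undoing of p on p(G), and p⁻¹ is applicable to p(G) at the comatch.
module PreToPost {T : Set} (p : Production T) (pre : Precondition p) where
  post : Postcondition p
  post = Translation.translated p pre

  equivalent : Equivalent p pre post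
  equivalent G μ ap = mk⇔ to from
    where
    open Match μ
    open Application p G μ ap
    module Tr = Translation.Correctness p pre G m m-inj m-typed (node pG) (edge pG) (edge-src pG) (edge-tgt pG)
                                        node-G-recovered edge-G-recovered
    module AtG = MatchAtoms p G μ ap (Translation.Src p pre) (Translation.srcArrow p pre)
    module AtpG = MatchAtoms (inverse p) pG (comatch p G μ) inverse-applicable
                             (Translation.Tgt p pre) (Translation.tgtArrow p pre)
    to : SatPre p pre G μ → SatPost p post G μ
    to (_ , _ , _ , hφ) =
      inverse-applicable , (_ , refl , AtpG.L-total) , (_ , refl , AtpG.K-total-co) ,
      proj₁ (Tr.Initial.initial-correct _ _ refl refl (λ _ → refl) refl (λ _ → refl)) hφ
    from : SatPost p post G μ → SatPre p pre G μ
    from (_ , _ , _ , hφ) =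
      ap , (_ , refl , AtG.L-total) , (_ , refl , AtG.K-total-co) ,
      proj₂ (Tr.Initial.initial-correct _ _ refl refl (λ _ → refl) refl (λ _ → refl)) hφ

-- From a postcondition to an equivalent precondition: translate along p⁻¹.
-- Now p(G) is the undoing of p⁻¹ on G, and p is applicable to G at μ.
module PostToPre {T : Set} (p : Production T) (post : Postcondition p) where
  pre : Precondition p
  pre = Translation.translated (inverse p) post

  equivalent : Equivalent p pre post
  equivalent G μ ap = mk⇔ to from
    where
    open Match μ
    open Application p G μ ap
    module Tr = Translation.Correctness (inverse p) post pG m m-inj m-typed (node G) (edge G) (edge-src G) (edge-tgt G)
                                        node-pG-produced edge-pG-produced
    module AtpG = MatchAtoms (inverse p) pG (comatch p G μ) inverse-applicable
                             (Translation.Src (inverse p) post) (Translation.srcArrow (inverse p) post)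
    module AtG = MatchAtoms p G μ ap (Translation.Tgt (inverse p) post) (Translation.tgtArrow (inverse p) post)
    to : SatPre p pre G μ → SatPost p post G μ
    to (_ , _ , _ , hφ) =
      inverse-applicable , (_ , refl , AtpG.L-total) , (_ , refl , AtpG.K-total-co) ,
      proj₂ (Tr.Initial.initial-correct _ _ refl refl (λ _ → refl) refl (λ _ → refl)) hφ
    from : SatPost p post G μ → SatPre p pre G μ
    from (_ , _ , _ , hφ) =
      ap , (_ , refl , AtG.L-total) , (_ , refl , AtG.K-total-co) ,
      proj₁ (Tr.Initial.initial-correct _ _ refl refl (λ _ → refl) refl (λ _ → refl)) hφ

module _ {T : Set} (p : Production T) (pre : Precondition p) (post : Postcondition p)
         (eqv : Equivalent p pre post) where
  consistent-pre→post : ConsistentPre p pre → ConsistentPost p post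
  consistent-pre→post (G , μ , ap , s) = G , μ , ap , Equivalence.to (eqv G μ ap) s

  consistent-post→pre : ConsistentPost p post → ConsistentPre p pre
  consistent-post→pre (G , μ , ap , s) = G , μ , ap , Equivalence.from (eqv G μ ap) s

theorem5p1 : (T : Set) (p : Production T) →
    ((pre : Precondition p) → ConsistentPre p pre →
       Σ (Postcondition p) (λ post → ConsistentPost p post × Equivalent p pre post))
    ×
    ((post : Postcondition p) → ConsistentPost p post →
       Σ (Precondition p) (λ pre → ConsistentPre p pre × Equivalent p pre post))
theorem5p1 T p = pre→post , post→pre
  where
  pre→post : (pre : Precondition p) → ConsistentPre p pre →
             Σ (Postcondition p) (λ post → ConsistentPost p post × Equivalent p pre post)
  pre→post pre c = post , consistent-pre→post p pre post equivalent c , equivalent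
    where open PreToPost p pre
  post→pre : (post : Postcondition p) → ConsistentPost p post →
             Σ (Precondition p) (λ pre → ConsistentPre p pre × Equivalent p pre post)
  post→pre post c = pre , consistent-post→pre p pre post equivalent c , equivalent
    where open PostToPre p post
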